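{- Let $D$ be the formal derivative on the ring of Laurent polynomials $\mathbb Q[u_1,u_2^{\pm1},u_3,v_1,v_2,t]$ with respect to the grammar $$\{u_1\rightarrow 3tu_2v_2,\ u_2\rightarrow 3tu_2v_1,\ u_3\rightarrow 3tu_2v_2,\ v_1\rightarrow 2(u_1+u_3),\ v_2\rightarrow 4u_1u_2^{ -1}u_3,\ t\rightarrow t^2v_1\}.$$ Then for every $n\ge1$, $$D^n(2u_3)=(n+2)!\,M_n(u_1,u_2,u_3;v_1,v_2;t).$$
   Context: A formal derivative with respect to a grammar (substitution rules $z\to f_z$ for variables $z$) is the linear operator $D$ with $D(z)=f_z$, $D(uv)=D(u)v+uD(v)$, $D(c)=0$ for constants. A plane tree is an unlabeled rooted tree in which the children of every vertex are linearly ordered. A leaf is a vertex with no children, an interior vertex one with at least one child. A tip-augmented plane tree is a plane tree in which the leftmost child of every interior vertex is a leaf; $\mathcal T_m$ is the set of tip-augmented plane trees with $m$ edges. In such a tree: a leaf without siblings is a singleton leaf; a leaf with siblings that is the leftmost child of its parent is an elder twin leaf if the second child of its parent is a leaf, and an elder non-twin leaf otherwise; a leaf with siblings that is the second child is a second leaf; a leaf with siblings that is neither first nor second child is a younger leaf. An edge is a young edge if its lower endpoint is not a singleton, elder twin or elder non-twin leaf. Let $\mathrm{sleaf},\mathrm{etleaf},\mathrm{entleaf},\mathrm{syleaf},\mathrm{yerleaf},\mathrm{yedge}$ count singleton, elder twin, elder non-twin, second and younger leaves and young edges. For $n\ge1$, $M_n(u_1,u_2,u_3;v_1,v_2;t)=\sum_{T\in\mathcal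 T_{n+1}}u_1^{\mathrm{sleaf}(T)}u_2^{\mathrm{etleaf}(T)}u_3^{\mathrm{entleaf}(T)}v_1^{\mathrm{yerleaf}(T)}v_2^{\mathrm{syleaf}(T)}t^{\mathrm{yedge}(T)}$. -}

module Defs where

open import Data.Bool using (Bool; true; false; if_then_else_; _∧_)
open import Data.Nat as ℕ using (ℕ; zero; suc)
open import Data.Integer as ℤ using (ℤ; +_)
open import Data.Rational as ℚ using (ℚ; 0ℚ; _/_)
open import Data.List using (List; []; _∷_; _++_; concatMap; map; length)
open import Data.Product using (_×_; _,_)
open import Relation.Binary.PropositionalEquality using (_≡_; refl; cong)
open import Relation.Nullary using (Dec; yes; no; ¬_)

-- Laurent polynomials in Q[u1, u2^{±1}, u3, v1, v2, t]
-- Variable order: u1, u2, u3, v1, v2, t.  Only u2 may carry a negative exponent.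

record Exp : Set where
  constructor exp
  field
    eu1 : ℕ
    eu2 : ℤ
    eu3 : ℕ
    ev1 : ℕ
    ev2 : ℕ
    et  : ℕ
open Exp public

infix 4 _≟E_
_≟E_ : (a b : Exp) → Dec (a ≡ b)
exp a1 a2 a3 a4 a5 a6 ≟E exp b1 b2 b3 b4 b5 b6
  with a1 ℕ.≟ b1 | a2 ℤ.≟ b2 | a3 ℕ.≟ b3 | a4 ℕ.≟ b4 | a5 ℕ.≟ b5 | a6 ℕ.≟ b6
... | yes refl | yes refl | yes refl | yes refl | yes refl | yes refl = yes refl
... | no p | _ | _ | _ | _ | _ = no λ { refl → p refl }
... | yes _ | no p | _ | _ | _ | _ = no λ { refl → p refl }
... | yes _ | yes _ | no p | _ | _ | _ = no λ { refl → p refl }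
... | yes _ | yes _ | yes _ | no p | _ | _ = no λ { refl → p refl }
... | yes _ | yes _ | yes _ | yes _ | no p | _ = no λ { refl → p refl }
... | yes _ | yes _ | yes _ | yes _ | yes _ | no p = no λ { refl → p refl }

-- A Laurent polynomial is represented by a finite formal sum of terms
-- (coefficient, exponent vector); two representations denote the same
-- element iff all their coefficients agree (relation _≈_ below).
Term : Set
Term = ℚ × Exp

Poly : Set
Poly = List Term

coeff : Poly → Exp → ℚ
coeff [] e = 0ℚ
coeff ((c , e′) ∷ p) e with e′ ≟E e
... | yes _ = c ℚ.+ coeff p e
... | no  _ = coeff p e

infix 4 _≈_
_≈_ : Poly → Poly → Set
p ≈ q = ∀ e → coeff p e ≡ coeff q e

qℕ : ℕ → ℚ
qℕ n = + n / 1

qℤ : ℤ → ℚ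
qℤ z = z / 1

infixl 6 _⊕_
_⊕_ : Poly → Poly → Poly
p ⊕ q = p ++ q

addE : Exp → Exp → Exp
addE (exp a1 a2 a3 a4 a5 a6) (exp b1 b2 b3 b4 b5 b6) =
  exp (a1 ℕ.+ b1) (a2 ℤ.+ b2) (a3 ℕ.+ b3) (a4 ℕ.+ b4) (a5 ℕ.+ b5) (a6 ℕ.+ b6)

infixl 7 _⊗_
_⊗_ : Poly → Poly → Poly
p ⊗ q = concatMap (λ { (c , e) → map (λ { (d , f) → (c ℚ.* d , addE e f) }) q }) p

_·_ : ℚ → Poly → Poly
k · p = map (λ { (c , e) → (k ℚ.* c , e) }) p

e0 : Exp
e0 = exp 0 (+ 0) 0 0 0 0

const : ℚ → Poly
const c = (c , e0) ∷ []

u1 u2 u2⁻¹ u3 v1 v2 t : Poly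
u1   = (ℚ.1ℚ , exp 1 (+ 0) 0 0 0 0) ∷ []
u2   = (ℚ.1ℚ , exp 0 (+ 1) 0 0 0 0) ∷ []
u2⁻¹ = (ℚ.1ℚ , exp 0 (ℤ.- (+ 1)) 0 0 0 0) ∷ []
u3   = (ℚ.1ℚ , exp 0 (+ 0) 1 0 0 0) ∷ []
v1   = (ℚ.1ℚ , exp 0 (+ 0) 0 1 0 0) ∷ []
v2   = (ℚ.1ℚ , exp 0 (+ 0) 0 0 1 0) ∷ []
t    = (ℚ.1ℚ , exp 0 (+ 0) 0 0 0 1) ∷ []

-- formal partial derivatives (termwise; a zero exponent gives coefficient 0)
∂u1 ∂u2 ∂u3 ∂v1 ∂v2 ∂t : Poly → Poly
∂u1 = map λ { (c , exp a1 a2 a3 a4 a5 a6) → (qℕ a1 ℚ.* c , exp (a1 ℕ.∸ 1) a2 a3 a4 a5 a6) }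
∂u2 = map λ { (c , exp a1 a2 a3 a4 a5 a6) → (qℤ a2 ℚ.* c , exp a1 (a2 ℤ.- + 1) a3 a4 a5 a6) }
∂u3 = map λ { (c , exp a1 a2 a3 a4 a5 a6) → (qℕ a3 ℚ.* c , exp a1 a2 (a3 ℕ.∸ 1) a4 a5 a6) }
∂v1 = map λ { (c , exp a1 a2 a3 a4 a5 a6) → (qℕ a4 ℚ.* c , exp a1 a2 a3 (a4 ℕ.∸ 1) a5 a6) }
∂v2 = map λ { (c , exp a1 a2 a3 a4 a5 a6) → (qℕ a5 ℚ.* c , exp a1 a2 a3 a4 (a5 ℕ.∸ 1) a6) }
∂t  = map λ { (c , exp a1 a2 a3 a4 a5 a6) → (qℕ a6 ℚ.* c , exp a1 a2 a3 a4 a5 (a6 ℕ.∸ 1)) }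

f-u1 f-u2 f-u3 f-v1 f-v2 f-t : Poly
f-u1 = qℕ 3 · (t ⊗ u2 ⊗ v2)
f-u2 = qℕ 3 · (t ⊗ u2 ⊗ v1)
f-u3 = qℕ 3 · (t ⊗ u2 ⊗ v2)
f-v1 = qℕ 2 · (u1 ⊕ u3)
f-v2 = qℕ 4 · (u1 ⊗ u2⁻¹ ⊗ u3)
f-t  = t ⊗ t ⊗ v1

-- The formal derivative w.r.t. the grammar: the unique derivation with
-- D(z) = f_z and D(c) = 0, i.e.  D = Σ_z f_z ∂/∂z.
D : Poly → Poly
D p = f-u1 ⊗ ∂u1 p ⊕ f-u2 ⊗ ∂u2 p ⊕ f-u3 ⊗ ∂u3 p
    ⊕ f-v1 ⊗ ∂v1 p ⊕ f-v2 ⊗ ∂v2 p ⊕ f-t ⊗ ∂t p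

D^ : ℕ → Poly → Poly
D^ zero    p = p
D^ (suc n) p = D (D^ n p)

data Tree : Set where
  node : List Tree → Tree

isLeaf : Tree → Bool
isLeaf (node []) = true
isLeaf (node (_ ∷ _)) = false

mutual
  edges : Tree → ℕ
  edges (node cs) = length cs ℕ.+ edgesL cs

  edgesL : List Tree → ℕ
  edgesL [] = 0
  edgesL (c ∷ cs) = edges c ℕ.+ edgesL cs

mutual
  tipAug : Tree → Bool
  tipAug (node []) = true
  tipAug (node (c ∷ cs)) = isLeaf c ∧ tipAugL (c ∷ cs)

  tipAugL : List Tree → Bool
  tipAugL [] = true
  tipAugL (c ∷ cs) = tipAug c ∧ tipAugL cs

record Stats : Set where
  constructor stats
  field
    sleaf etleaf entleaf syleaf yerleaf yedge : ℕ
open Stats public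

zS : Stats
zS = stats 0 0 0 0 0 0

infixl 6 _+S_
_+S_ : Stats → Stats → Stats
stats a b c d e f +S stats a′ b′ c′ d′ e′ f′ =
  stats (a ℕ.+ a′) (b ℕ.+ b′) (c ℕ.+ c′) (d ℕ.+ d′) (e ℕ.+ e′) (f ℕ.+ f′)

b2n : Bool → ℕ
b2n true = 1
b2n false = 0

-- contribution of children at positions ≥ 3 (edge is young; leaf is younger)
younger : List Tree → Stats
younger [] = zS
younger (c ∷ cs) = stats 0 0 0 0 (b2n (isLeaf c)) 1 +S younger cs

-- contribution of the children of one vertex (their type as leaves and
-- the young-ness of the edges from the vertex to them)
top : List Tree → Stats
top [] = zS
top (c ∷ []) =
  if isLeaf c then stats 1 0 0 0 0 0     -- singleton leaf, edge not young
              else stats 0 0 0 0 0 1     -- lower endpoint not a leaf: young edge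
top (c1 ∷ c2 ∷ rest) =
  first +S stats 0 0 0 (b2n (isLeaf c2)) 0 1 +S younger rest
  where
  first : Stats
  first = if isLeaf c1
            then (if isLeaf c2 then stats 0 1 0 0 0 0 else stats 0 0 1 0 0 0)
            else stats 0 0 0 0 0 1

mutual
  treeStats : Tree → Stats
  treeStats (node cs) = top cs +S treeStatsL cs

  treeStatsL : List Tree → Stats
  treeStatsL [] = zS
  treeStatsL (c ∷ cs) = treeStats c +S treeStatsL cs

weight : Tree → Term
weight T = (ℚ.1ℚ , exp (sleaf s) (+ etleaf s) (entleaf s) (yerleaf s) (syleaf s) (yedge s))
  where s = treeStats T

-- M over a (duplicate-free, exhaustive) enumeration of T_{n+1}
Msum : List Tree → Poly
Msum = map weight

IsTipAugEnum : ℕ → List Tree → Set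
IsTipAugEnum m ts = ∀ T → (T ∈ ts → tipAug T ≡ true × edges T ≡ m)
                        × (tipAug T ≡ true → edges T ≡ m → T ∈ ts)
  where open import Data.List.Membership.Propositional using (_∈_)

-- Grade monomials by deg = exponent of u1 + of u3 + of v2 + of t. Each right-hand side f_z is
-- homogeneous of degree deg z + 1, so D raises degrees by exactly one, and Δ = D − θ, with θ
-- the Euler operator of the grading, is a derivation that preserves degrees.
--
-- A non-leaf tip-augmented tree is a root with a single leaf child (weight u1), or a root with
-- children leaf, c, followed by younger children f, whose weight factors as t · q(c) · a(f),
-- with q(leaf) = u2 v2, q(c) = u3 · weight(c) otherwise, and a multiplicative. So the generating
-- function N of the non-leaf trees, whose part of degree m is M_(m-1), and the generating
-- function A of the lists of younger children satisfy
--   A = 1 + t (v1 + N) A,   N = u1 + t (u2 v2 + u3 N) A.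
-- Applying Δ to these equations and inducting on the degree gives simultaneously
--   Δ A = κ A²  with κ = t² v1 (v1 + N) − t v1 + 2 t u3,   and   Δ N = N − 2 u1.
-- In degree m + 1 ≥ 2 the latter says D M_(m-1) = (m + 1) M_m + M_m, so D M_n = (n + 3) M_(n+1),
-- and the theorem follows by induction from D (2 u3) = 6 t u2 v2 = 3! M_1.
-- The trees are enumerated up to an edge bound, so these equations hold only in low degrees;
-- p ≈[ k ] q says that p and q agree in all degrees below k.

module Submission where

open import Defs
open import Data.Nat using (ℕ; suc; _+_; _≤_; _!)
open import Data.List using (List)
open import Data.List.Relation.Unary.Unique.Propositional using (Unique)

open import Algebra.Bundles using (CommutativeRing)
open import Algebra.Solver.Ring.AlmostCommutativeRing using (fromCommutativeRing; _-Raw-AlmostCommutative⟶_)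
import Algebra.Solver.Ring as RingSolver
open import Algebra.Structures using (IsCommutativeRing)
open import Data.Bool using (true; _∧_)
open import Data.Bool.Properties using (∧-conicalˡ; ∧-conicalʳ)
open import Data.Empty using (⊥-elim)
open import Data.Integer as ℤ using (+_)
import Data.Integer.Properties as ℤₚ
open import Data.List as List using ([]; _∷_; _++_; map; length; filter; cartesianProductWith)
import Data.List.Properties as Listₚ
open import Data.List.Membership.DecPropositional _≟E_ using (_∈?_)
open import Data.List.Membership.Propositional using (_∈_)
open import Data.List.Membership.Propositional.Properties
  using (∈-++⁺ˡ; ∈-++⁺ʳ; ∈-filter⁺; ∈-filter⁻; ∈-cartesianProductWith⁺; ∈-cartesianProductWith⁻)
open import Data.List.Membership.Propositional.Properties.WithK using (unique∧set⇒bag)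
open import Data.List.Relation.Binary.BagAndSetEquality using (∼bag⇒↭)
open import Data.List.Relation.Binary.Permutation.Propositional as ↭ using (_↭_)
import Data.List.Relation.Binary.Permutation.Propositional.Properties as ↭ₚ
open import Data.List.Relation.Unary.All as All using (All; []; _∷_; all?)
import Data.List.Relation.Unary.All.Properties as Allₚ
open import Data.List.Relation.Unary.Any using (here; there)
open import Data.List.Relation.Unary.Unique.Propositional using ([]; _∷_)
import Data.List.Relation.Unary.Unique.Propositional.Properties as Uniqueₚ
import Data.Maybe as Maybe
open import Data.Nat as ℕ using (zero; _<_; z≤n; s≤s)
import Data.Nat.Coprimality as Coprimality
import Data.Nat.Properties as ℕₚ
import Data.Nat.Solver as ℕSolver
open import Data.Product using (_×_; _,_; proj₁; proj₂; ∃)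
open import Data.Rational as ℚ using (ℚ; 0ℚ; 1ℚ)
import Data.Rational.Properties as ℚₚ
import Data.Rational.Solver as ℚSolver
open import Data.Sum as Sum using (_⊎_; inj₁; inj₂)
open import Function.Bundles using (mk⇔)
open import Relation.Binary.Bundles using (Setoid)
open import Relation.Binary.PropositionalEquality
import Relation.Binary.Reasoning.Setoid as SetoidReasoning
open import Relation.Nullary using (Dec; yes; no; ¬_)
open import Relation.Nullary.Decidable using (True; toWitness; dec⇒maybe)

-- Coefficients as linear functionals

-- A record rather than Defs' function type _≈_, so that Agda can infer both sides from a proof.
infix 4 _≋_
record _≋_ (p q : Poly) : Set where
  constructor mk≋
  field coeff≡ : ∀ e → coeff p e ≡ coeff q e
open _≋_ public

δ : Exp → Exp → ℚ
δ e f with f ≟E e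
... | yes _ = 1ℚ
... | no  _ = 0ℚ

lin : (Exp → ℚ) → Poly → ℚ
lin φ [] = 0ℚ
lin φ ((c , f) ∷ p) = c ℚ.* φ f ℚ.+ lin φ p

module _ where
  open ℚSolver.+-*-Solver

  coeff-lin : ∀ p e → coeff p e ≡ lin (δ e) p
  coeff-lin [] e = refl
  coeff-lin ((c , f) ∷ p) e with f ≟E e
  ... | yes _ = cong₂ ℚ._+_ (sym (ℚₚ.*-identityʳ c)) (coeff-lin p e)
  ... | no  _ = trans (coeff-lin p e)
    (solve 2 (λ c x → x := c :* con 0ℚ :+ x) refl c (lin (δ e) p))

  lin-++ : ∀ φ p q → lin φ (p ++ q) ≡ lin φ p ℚ.+ lin φ q
  lin-++ φ [] q = sym (ℚₚ.+-identityˡ _)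
  lin-++ φ ((c , f) ∷ p) q = trans (cong (c ℚ.* φ f ℚ.+_) (lin-++ φ p q))
    (sym (ℚₚ.+-assoc (c ℚ.* φ f) (lin φ p) (lin φ q)))

  lin-cong : ∀ {φ ψ} → (∀ f → φ f ≡ ψ f) → ∀ p → lin φ p ≡ lin ψ p
  lin-cong h [] = refl
  lin-cong h ((c , f) ∷ p) = cong₂ (λ a b → c ℚ.* a ℚ.+ b) (h f) (lin-cong h p)

  lin-vanish : ∀ {φ} p → All (λ t → φ (proj₂ t) ≡ 0ℚ) p → lin φ p ≡ 0ℚ
  lin-vanish [] [] = refl
  lin-vanish ((c , f) ∷ p) (φf≡0 ∷ h) =
    trans (cong₂ (λ a b → c ℚ.* a ℚ.+ b) φf≡0 (lin-vanish p h)) (solve 1 (λ c → c :* con 0ℚ :+ con 0ℚ := con 0ℚ) refl c)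

  lin-cong-on : ∀ {φ ψ} p → All (λ t → φ (proj₂ t) ≡ ψ (proj₂ t)) p → lin φ p ≡ lin ψ p
  lin-cong-on [] [] = refl
  lin-cong-on ((c , f) ∷ p) (φf≡ψf ∷ h) = cong₂ (λ a b → c ℚ.* a ℚ.+ b) φf≡ψf (lin-cong-on p h)

  lin-+ : ∀ φ ψ p → lin (λ f → φ f ℚ.+ ψ f) p ≡ lin φ p ℚ.+ lin ψ p
  lin-+ φ ψ [] = refl
  lin-+ φ ψ ((c , f) ∷ p) = trans (cong (c ℚ.* (φ f ℚ.+ ψ f) ℚ.+_) (lin-+ φ ψ p))
    (solve 5 (λ c a b x y → c :* (a :+ b) :+ (x :+ y) := (c :* a :+ x) :+ (c :* b :+ y))
      refl c (φ f) (ψ f) (lin φ p) (lin ψ p))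

  lin-scale : ∀ k φ p → lin (λ f → k ℚ.* φ f) p ≡ k ℚ.* lin φ p
  lin-scale k φ [] = sym (ℚₚ.*-zeroʳ k)
  lin-scale k φ ((c , f) ∷ p) = trans (cong (c ℚ.* (k ℚ.* φ f) ℚ.+_) (lin-scale k φ p))
    (solve 4 (λ c k a x → c :* (k :* a) :+ k :* x := k :* (c :* a :+ x)) refl c k (φ f) (lin φ p))

  lin-swap : ∀ (K : Exp → Exp → ℚ) p q →
    lin (λ f → lin (K f) q) p ≡ lin (λ g → lin (λ f → K f g) p) q
  lin-swap K [] q = sym (lin-vanish q (All.tabulate λ _ → refl))
  lin-swap K ((c , f) ∷ p) q = begin
      c ℚ.* lin (K f) q ℚ.+ lin (λ f → lin (K f) q) p
    ≡⟨ cong₂ ℚ._+_ (sym (lin-scale c (K f) q)) (lin-swap K p q) ⟩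
      lin (λ g → c ℚ.* K f g) q ℚ.+ lin (λ g → lin (λ f → K f g) p) q
    ≡⟨ sym (lin-+ (λ g → c ℚ.* K f g) (λ g → lin (λ f → K f g) p) q) ⟩
      lin (λ g → c ℚ.* K f g ℚ.+ lin (λ f → K f g) p) q
    ∎
    where open ≡-Reasoning

remove : Exp → Poly → Poly
remove f [] = []
remove f ((c , g) ∷ p) with g ≟E f
... | yes _ = remove f p
... | no  _ = (c , g) ∷ remove f p

module _ where
  open ℚSolver.+-*-Solver

  lin-remove : ∀ φ f p → lin φ p ≡ coeff p f ℚ.* φ f ℚ.+ lin φ (remove f p)
  lin-remove φ f [] = sym (solve 1 (λ a → con 0ℚ :* a :+ con 0ℚ := con 0ℚ) refl (φ f))
  lin-remove φ f ((c , g) ∷ p) with g ≟E f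
  ... | yes refl = trans (cong (c ℚ.* φ g ℚ.+_) (lin-remove φ g p))
    (solve 4 (λ c a x r → c :* a :+ (x :* a :+ r) := (c :+ x) :* a :+ r) refl c (φ g) (coeff p g) (lin φ (remove g p)))
  ... | no _ = trans (cong (c ℚ.* φ g ℚ.+_) (lin-remove φ f p))
    (solve 4 (λ c a x r → c :* a :+ (x :+ r) := x :+ (c :* a :+ r)) refl c (φ g) (coeff p f ℚ.* φ f) (lin φ (remove f p)))

coeff-remove-self : ∀ f p → coeff (remove f p) f ≡ 0ℚ
coeff-remove-self f [] = refl
coeff-remove-self f ((c , g) ∷ p) with g ≟E f
... | yes _ = coeff-remove-self f p
... | no g≢f with g ≟E f
...   | yes g≡f = ⊥-elim (g≢f g≡f)
...   | no _    = coeff-remove-self f p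

coeff-remove-other : ∀ f e p → f ≢ e → coeff (remove f p) e ≡ coeff p e
coeff-remove-other f e [] _ = refl
coeff-remove-other f e ((c , g) ∷ p) f≢e with g ≟E f
... | yes refl with g ≟E e
...   | yes g≡e = ⊥-elim (f≢e g≡e)
...   | no _    = coeff-remove-other f e p f≢e
coeff-remove-other f e ((c , g) ∷ p) f≢e | no _ with g ≟E e
...   | yes _ = cong (c ℚ.+_) (coeff-remove-other f e p f≢e)
...   | no  _ = coeff-remove-other f e p f≢e

length-remove : ∀ f p → length (remove f p) ≤ length p
length-remove f [] = z≤n
length-remove f ((c , g) ∷ p) with g ≟E f
... | yes _ = ℕₚ.m≤n⇒m≤1+n (length-remove f p)
... | no  _ = s≤s (length-remove f p)

length-remove-head : ∀ c f p → length (remove f ((c , f) ∷ p)) ≤ length p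
length-remove-head c f p with f ≟E f
... | yes _   = length-remove f p
... | no f≢f = ⊥-elim (f≢f refl)

-- Induction on the total number of terms: split off all terms of one exponent from both sides.
lin-resp : ∀ {φ} p q → (∀ f → φ f ≡ 0ℚ ⊎ coeff p f ≡ coeff q f) → lin φ p ≡ lin φ q
lin-resp {φ} p q = go _ p q ℕₚ.≤-refl
  where
  mutual
    go : ∀ n p q → length p + length q ≤ n → (∀ f → φ f ≡ 0ℚ ⊎ coeff p f ≡ coeff q f) → lin φ p ≡ lin φ q
    go n [] [] _ _ = refl
    go (suc n) p@((c , f) ∷ p′) q (s≤s size) agree =
      split n f p q (ℕₚ.≤-trans (ℕₚ.+-mono-≤ (length-remove-head c f p′) (length-remove f q)) size) agree
    go (suc n) [] q@((c , f) ∷ q′) (s≤s size) agree =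
      split n f [] q (ℕₚ.≤-trans (length-remove-head c f q′) size) agree

    split : ∀ n f p q → length (remove f p) + length (remove f q) ≤ n →
      (∀ f → φ f ≡ 0ℚ ⊎ coeff p f ≡ coeff q f) → lin φ p ≡ lin φ q
    split n f p q size agree = begin
        lin φ p                                        ≡⟨ lin-remove φ f p ⟩
        coeff p f ℚ.* φ f ℚ.+ lin φ (remove f p)       ≡⟨ cong₂ ℚ._+_ head (go n (remove f p) (remove f q) size agree′) ⟩
        coeff q f ℚ.* φ f ℚ.+ lin φ (remove f q)       ≡⟨ lin-remove φ f q ⟨
        lin φ q                                        ∎
      where
      open ≡-Reasoning
      head : coeff p f ℚ.* φ f ≡ coeff q f ℚ.* φ f
      head with agree f
      ... | inj₁ φf≡0 = trans (cong (coeff p f ℚ.*_) φf≡0)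
        (trans (ℚₚ.*-zeroʳ (coeff p f)) (sym (trans (cong (coeff q f ℚ.*_) φf≡0) (ℚₚ.*-zeroʳ (coeff q f)))))
      ... | inj₂ same = cong (ℚ._* φ f) same
      agree′ : ∀ g → φ g ≡ 0ℚ ⊎ coeff (remove f p) g ≡ coeff (remove f q) g
      agree′ g with f ≟E g | agree g
      ... | yes refl | _ = inj₂ (trans (coeff-remove-self f p) (sym (coeff-remove-self f q)))
      ... | no _ | inj₁ φg≡0 = inj₁ φg≡0
      ... | no f≢g | inj₂ same =
        inj₂ (trans (coeff-remove-other f g p f≢g) (trans same (sym (coeff-remove-other f g q f≢g))))

lin-≋ : ∀ φ {p q} → p ≋ q → lin φ p ≡ lin φ q
lin-≋ φ {p} {q} p≋q = lin-resp p q (λ f → inj₂ (coeff≡ p≋q f))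

-- The ring of Laurent polynomials

addE-comm : ∀ f g → addE f g ≡ addE g f
addE-comm (exp a₁ a₂ a₃ a₄ a₅ a₆) (exp b₁ b₂ b₃ b₄ b₅ b₆)
  rewrite ℕₚ.+-comm a₁ b₁ | ℤₚ.+-comm a₂ b₂ | ℕₚ.+-comm a₃ b₃
        | ℕₚ.+-comm a₄ b₄ | ℕₚ.+-comm a₅ b₅ | ℕₚ.+-comm a₆ b₆ = refl

addE-assoc : ∀ f g h → addE (addE f g) h ≡ addE f (addE g h)
addE-assoc (exp a₁ a₂ a₃ a₄ a₅ a₆) (exp b₁ b₂ b₃ b₄ b₅ b₆) (exp c₁ c₂ c₃ c₄ c₅ c₆)
  rewrite ℕₚ.+-assoc a₁ b₁ c₁ | ℤₚ.+-assoc a₂ b₂ c₂ | ℕₚ.+-assoc a₃ b₃ c₃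
        | ℕₚ.+-assoc a₄ b₄ c₄ | ℕₚ.+-assoc a₅ b₅ c₅ | ℕₚ.+-assoc a₆ b₆ c₆ = refl

addE-identityˡ : ∀ f → addE e0 f ≡ f
addE-identityˡ (exp a₁ a₂ a₃ a₄ a₅ a₆) rewrite ℤₚ.+-identityˡ a₂ = refl

monoMap : (Exp → ℚ) → (Exp → Exp) → Poly → Poly
monoMap k d = map λ (c , f) → (k f ℚ.* c , d f)

lin-monoMap : ∀ φ k d p → lin φ (monoMap k d p) ≡ lin (λ f → k f ℚ.* φ (d f)) p
lin-monoMap φ k d [] = refl
lin-monoMap φ k d ((c , f) ∷ p) = cong₂ ℚ._+_ (solve 3 (λ k c a → (k :* c) :* a := c :* (k :* a)) refl (k f) c (φ (d f)))
  (lin-monoMap φ k d p)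
  where open ℚSolver.+-*-Solver

lin-⊗ : ∀ φ p q → lin φ (p ⊗ q) ≡ lin (λ f → lin (λ g → φ (addE f g)) q) p
lin-⊗ φ [] q = refl
lin-⊗ φ ((c , f) ∷ p) q = trans (lin-++ φ (monoMap (λ _ → c) (addE f) q) (p ⊗ q))
  (cong₂ ℚ._+_ (trans (lin-monoMap φ (λ _ → c) (addE f) q) (lin-scale c (λ g → φ (addE f g)) q)) (lin-⊗ φ p q))

coeff-⊗ : ∀ p q e → coeff (p ⊗ q) e ≡ lin (λ f → lin (λ g → δ e (addE f g)) q) p
coeff-⊗ p q e = trans (coeff-lin (p ⊗ q) e) (lin-⊗ (δ e) p q)

coeff-++ : ∀ p q e → coeff (p ++ q) e ≡ coeff p e ℚ.+ coeff q e
coeff-++ p q e = trans (coeff-lin (p ++ q) e)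
  (trans (lin-++ (δ e) p q) (sym (cong₂ ℚ._+_ (coeff-lin p e) (coeff-lin q e))))

coeff-monoMap : ∀ k d p e → coeff (monoMap k d p) e ≡ lin (λ f → k f ℚ.* δ e (d f)) p
coeff-monoMap k d p e = trans (coeff-lin (monoMap k d p) e) (lin-monoMap (δ e) k d p)

coeff-· : ∀ k p e → coeff (k · p) e ≡ k ℚ.* coeff p e
coeff-· k p e = trans (coeff-monoMap (λ _ → k) (λ f → f) p e)
  (trans (lin-scale k (δ e) p) (cong (k ℚ.*_) (sym (coeff-lin p e))))

neg : Poly → Poly
neg p = (ℚ.- 1ℚ) · p

coeff-neg : ∀ p e → coeff (neg p) e ≡ ℚ.- coeff p e
coeff-neg p e = trans (coeff-· (ℚ.- 1ℚ) p e) (solve 1 (λ x → con (ℚ.- 1ℚ) :* x := :- x) refl (coeff p e))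
  where open ℚSolver.+-*-Solver

infixl 6 _⊖_
_⊖_ : Poly → Poly → Poly
p ⊖ q = p ⊕ neg q

coeff-⊖ : ∀ p q e → coeff (p ⊖ q) e ≡ coeff p e ℚ.- coeff q e
coeff-⊖ p q e = trans (coeff-++ p (neg q) e) (cong (coeff p e ℚ.+_) (coeff-neg q e))

1P : Poly
1P = const 1ℚ

≋-refl : ∀ {p} → p ≋ p
≋-refl = mk≋ λ _ → refl

≋-reflexive : ∀ {p q} → p ≡ q → p ≋ q
≋-reflexive refl = ≋-refl

≋-sym : ∀ {p q} → p ≋ q → q ≋ p
≋-sym p≋q = mk≋ λ e → sym (coeff≡ p≋q e)

≋-trans : ∀ {p q r} → p ≋ q → q ≋ r → p ≋ r
≋-trans p≋q q≋r = mk≋ λ e → trans (coeff≡ p≋q e) (coeff≡ q≋r e)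

≋-setoid : Setoid _ _
≋-setoid = record { Carrier = Poly ; _≈_ = _≋_ ; isEquivalence = record { refl = ≋-refl ; sym = ≋-sym ; trans = ≋-trans } }

module ≋-Reasoning = SetoidReasoning ≋-setoid

⊕-cong : ∀ {p p′ q q′} → p ≋ p′ → q ≋ q′ → p ⊕ q ≋ p′ ⊕ q′
⊕-cong {p} {p′} {q} {q′} p≋p′ q≋q′ = mk≋ λ e →
  trans (coeff-++ p q e) (trans (cong₂ ℚ._+_ (coeff≡ p≋p′ e) (coeff≡ q≋q′ e)) (sym (coeff-++ p′ q′ e)))

⊗-cong : ∀ {p p′ q q′} → p ≋ p′ → q ≋ q′ → p ⊗ q ≋ p′ ⊗ q′
⊗-cong {p} {p′} {q} {q′} p≋p′ q≋q′ = mk≋ λ e → begin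
    coeff (p ⊗ q) e                                       ≡⟨ coeff-⊗ p q e ⟩
    lin (λ f → lin (λ g → δ e (addE f g)) q) p            ≡⟨ lin-≋ _ p≋p′ ⟩
    lin (λ f → lin (λ g → δ e (addE f g)) q) p′           ≡⟨ lin-cong (λ f → lin-≋ _ q≋q′) p′ ⟩
    lin (λ f → lin (λ g → δ e (addE f g)) q′) p′          ≡⟨ coeff-⊗ p′ q′ e ⟨
    coeff (p′ ⊗ q′) e                                     ∎
  where open ≡-Reasoning

⊕-congˡ : ∀ p {q q′} → q ≋ q′ → p ⊕ q ≋ p ⊕ q′
⊕-congˡ p = ⊕-cong (≋-refl {p})

⊕-congʳ : ∀ {p p′} → p ≋ p′ → ∀ q → p ⊕ q ≋ p′ ⊕ q
⊕-congʳ p≋p′ q = ⊕-cong p≋p′ (≋-refl {q})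

⊗-congˡ : ∀ p {q q′} → q ≋ q′ → p ⊗ q ≋ p ⊗ q′
⊗-congˡ p = ⊗-cong (≋-refl {p})

⊗-congʳ : ∀ {p p′} → p ≋ p′ → ∀ q → p ⊗ q ≋ p′ ⊗ q
⊗-congʳ p≋p′ q = ⊗-cong p≋p′ (≋-refl {q})

neg-cong : ∀ {p q} → p ≋ q → neg p ≋ neg q
neg-cong {p} {q} p≋q = mk≋ λ e → trans (coeff-neg p e) (trans (cong ℚ.-_ (coeff≡ p≋q e)) (sym (coeff-neg q e)))

⊕-assoc : ∀ p q r → (p ⊕ q) ⊕ r ≋ p ⊕ (q ⊕ r)
⊕-assoc p q r = ≋-reflexive (Listₚ.++-assoc p q r)

⊕-comm : ∀ p q → p ⊕ q ≋ q ⊕ p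
⊕-comm p q = mk≋ λ e → trans (coeff-++ p q e) (trans (ℚₚ.+-comm (coeff p e) (coeff q e)) (sym (coeff-++ q p e)))

⊕-identityˡ : ∀ p → [] ⊕ p ≋ p
⊕-identityˡ p = ≋-refl

⊕-identityʳ : ∀ p → p ⊕ [] ≋ p
⊕-identityʳ p = ≋-reflexive (Listₚ.++-identityʳ p)

neg-inverseˡ : ∀ p → neg p ⊕ p ≋ []
neg-inverseˡ p = mk≋ λ e → trans (coeff-++ (neg p) p e)
  (trans (cong (ℚ._+ coeff p e) (coeff-neg p e)) (ℚₚ.+-inverseˡ (coeff p e)))

neg-inverseʳ : ∀ p → p ⊕ neg p ≋ []
neg-inverseʳ p = ≋-trans (⊕-comm p (neg p)) (neg-inverseˡ p)

⊗-comm : ∀ p q → p ⊗ q ≋ q ⊗ p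
⊗-comm p q = mk≋ λ e → begin
    coeff (p ⊗ q) e                                 ≡⟨ coeff-⊗ p q e ⟩
    lin (λ f → lin (λ g → δ e (addE f g)) q) p      ≡⟨ lin-swap (λ f g → δ e (addE f g)) p q ⟩
    lin (λ g → lin (λ f → δ e (addE f g)) p) q      ≡⟨ lin-cong (λ g → lin-cong (λ f → cong (δ e) (addE-comm f g)) p) q ⟩
    lin (λ g → lin (λ f → δ e (addE g f)) p) q      ≡⟨ coeff-⊗ q p e ⟨
    coeff (q ⊗ p) e                                 ∎
  where open ≡-Reasoning

⊗-assoc : ∀ p q r → (p ⊗ q) ⊗ r ≋ p ⊗ (q ⊗ r)
⊗-assoc p q r = mk≋ λ e → begin
    coeff ((p ⊗ q) ⊗ r) e
  ≡⟨ coeff-⊗ (p ⊗ q) r e ⟩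
    lin (λ fg → lin (λ h → δ e (addE fg h)) r) (p ⊗ q)
  ≡⟨ lin-⊗ (λ fg → lin (λ h → δ e (addE fg h)) r) p q ⟩
    lin (λ f → lin (λ g → lin (λ h → δ e (addE (addE f g) h)) r) q) p
  ≡⟨ lin-cong (λ f → lin-cong (λ g → lin-cong (λ h → cong (δ e) (addE-assoc f g h)) r) q) p ⟩
    lin (λ f → lin (λ g → lin (λ h → δ e (addE f (addE g h))) r) q) p
  ≡⟨ lin-cong (λ f → lin-⊗ (λ gh → δ e (addE f gh)) q r) p ⟨
    lin (λ f → lin (λ gh → δ e (addE f gh)) (q ⊗ r)) p
  ≡⟨ coeff-⊗ p (q ⊗ r) e ⟨
    coeff (p ⊗ (q ⊗ r)) e
  ∎
  where open ≡-Reasoning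

⊗-identityˡ : ∀ p → 1P ⊗ p ≋ p
⊗-identityˡ p = mk≋ λ e → begin
    coeff (1P ⊗ p) e                                    ≡⟨ coeff-⊗ 1P p e ⟩
    1ℚ ℚ.* lin (λ g → δ e (addE e0 g)) p ℚ.+ 0ℚ         ≡⟨ solve 1 (λ x → con 1ℚ :* x :+ con 0ℚ := x) refl _ ⟩
    lin (λ g → δ e (addE e0 g)) p                       ≡⟨ lin-cong (λ g → cong (δ e) (addE-identityˡ g)) p ⟩
    lin (δ e) p                                         ≡⟨ coeff-lin p e ⟨
    coeff p e                                           ∎
  where
  open ≡-Reasoning
  open ℚSolver.+-*-Solver

⊗-identityʳ : ∀ p → p ⊗ 1P ≋ p
⊗-identityʳ p = ≋-trans (⊗-comm p 1P) (⊗-identityˡ p)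

⊗-distribʳ : ∀ p q r → (q ⊕ r) ⊗ p ≋ q ⊗ p ⊕ r ⊗ p
⊗-distribʳ p q r = mk≋ λ e → trans (coeff-⊗ (q ⊕ r) p e)
  (trans (lin-++ _ q r) (sym (trans (coeff-++ (q ⊗ p) (r ⊗ p) e) (cong₂ ℚ._+_ (coeff-⊗ q p e) (coeff-⊗ r p e)))))

⊗-distribˡ : ∀ p q r → p ⊗ (q ⊕ r) ≋ p ⊗ q ⊕ p ⊗ r
⊗-distribˡ p q r =
  ≋-trans (⊗-comm p (q ⊕ r)) (≋-trans (⊗-distribʳ p q r) (⊕-cong (⊗-comm q p) (⊗-comm r p)))

Poly-isCommutativeRing : IsCommutativeRing _≋_ _⊕_ _⊗_ neg [] 1P
Poly-isCommutativeRing = record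
  { isRing = record
    { +-isAbelianGroup = record
      { isGroup = record
        { isMonoid = record
          { isSemigroup = record
            { isMagma = record
              { isEquivalence = Setoid.isEquivalence ≋-setoid
              ; ∙-cong = ⊕-cong }
            ; assoc = ⊕-assoc }
          ; identity = ⊕-identityˡ , ⊕-identityʳ }
        ; inverse = neg-inverseˡ , neg-inverseʳ
        ; ⁻¹-cong = neg-cong }
      ; comm = ⊕-comm }
    ; *-cong = ⊗-cong
    ; *-assoc = ⊗-assoc
    ; *-identity = ⊗-identityˡ , ⊗-identityʳ
    ; distrib = ⊗-distribˡ , ⊗-distribʳ }
  ; *-comm = ⊗-comm }

Poly-commutativeRing : CommutativeRing _ _
Poly-commutativeRing = record { isCommutativeRing = Poly-isCommutativeRing }

coeff-const : ∀ c e → coeff (const c) e ≡ c ℚ.* δ e e0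
coeff-const c e = trans (coeff-lin (const c) e) (ℚₚ.+-identityʳ (c ℚ.* δ e e0))

const-homomorphism : ℚₚ.+-*-rawRing -Raw-AlmostCommutative⟶ fromCommutativeRing Poly-commutativeRing
const-homomorphism = record
  { ⟦_⟧    = const
  ; +-homo = λ a b → mk≋ λ e → trans (coeff-const (a ℚ.+ b) e) (trans (ℚₚ.*-distribʳ-+ (δ e e0) a b)
      (sym (trans (coeff-++ (const a) (const b) e) (cong₂ ℚ._+_ (coeff-const a e) (coeff-const b e)))))
  ; *-homo = λ _ _ → ≋-refl
  ; -‿homo = λ a → mk≋ λ e → trans (coeff-const (ℚ.- a) e) (trans (sym (ℚₚ.neg-distribˡ-* a (δ e e0)))
      (sym (trans (coeff-neg (const a) e) (cong ℚ.-_ (coeff-const a e)))))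
  ; 0-homo = mk≋ λ e → trans (coeff-const 0ℚ e) (ℚₚ.*-zeroˡ (δ e e0))
  ; 1-homo = ≋-refl }

const-≟ : ∀ a b → Maybe.Maybe (const a ≋ const b)
const-≟ a b = Maybe.map (λ a≡b → ≋-reflexive (cong const a≡b)) (dec⇒maybe (a ℚₚ.≟ b))

module PolySolver = RingSolver ℚₚ.+-*-rawRing (fromCommutativeRing Poly-commutativeRing) const-homomorphism const-≟

qℤ≡mkℚ : ∀ z → qℤ z ≡ ℚ.mkℚ z 0 (Coprimality.sym (Coprimality.1-coprimeTo ℤ.∣ z ∣))
qℤ≡mkℚ z = ℚₚ.↥p/↧p≡p _

qℤ-+ : ∀ a b → qℤ (a ℤ.+ b) ≡ qℤ a ℚ.+ qℤ b
qℤ-+ a b = sym (trans (cong₂ ℚ._+_ (qℤ≡mkℚ a) (qℤ≡mkℚ b))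
  (cong (ℚ._/ 1) (cong₂ ℤ._+_ (ℤₚ.*-identityʳ a) (ℤₚ.*-identityʳ b))))

qℕ-+ : ∀ a b → qℕ (a ℕ.+ b) ≡ qℕ a ℚ.+ qℕ b
qℕ-+ a b = qℤ-+ (+ a) (+ b)

qℕ-* : ∀ a b → qℕ (a ℕ.* b) ≡ qℕ a ℚ.* qℕ b
qℕ-* a b = sym (trans (cong₂ ℚ._*_ (qℤ≡mkℚ (+ a)) (qℤ≡mkℚ (+ b))) (cong (ℚ._/ 1) (sym (ℤₚ.pos-* a b))))

-- The derivation D and its grading

data Var : Set where
  𝑢₁ 𝑢₂ 𝑢₃ 𝑣₁ 𝑣₂ 𝑡 : Var

grammar : Var → Poly
grammar 𝑢₁ = f-u1
grammar 𝑢₂ = f-u2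
grammar 𝑢₃ = f-u3
grammar 𝑣₁ = f-v1
grammar 𝑣₂ = f-v2
grammar 𝑡  = f-t

exponent : Var → Exp → ℚ
exponent 𝑢₁ f = qℕ (eu1 f)
exponent 𝑢₂ f = qℤ (eu2 f)
exponent 𝑢₃ f = qℕ (eu3 f)
exponent 𝑣₁ f = qℕ (ev1 f)
exponent 𝑣₂ f = qℕ (ev2 f)
exponent 𝑡  f = qℕ (et f)

lower : Var → Exp → Exp
lower 𝑢₁ (exp a₁ a₂ a₃ a₄ a₅ a₆) = exp (a₁ ℕ.∸ 1) a₂ a₃ a₄ a₅ a₆
lower 𝑢₂ (exp a₁ a₂ a₃ a₄ a₅ a₆) = exp a₁ (a₂ ℤ.- + 1) a₃ a₄ a₅ a₆
lower 𝑢₃ (exp a₁ a₂ a₃ a₄ a₅ a₆) = exp a₁ a₂ (a₃ ℕ.∸ 1) a₄ a₅ a₆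
lower 𝑣₁ (exp a₁ a₂ a₃ a₄ a₅ a₆) = exp a₁ a₂ a₃ (a₄ ℕ.∸ 1) a₅ a₆
lower 𝑣₂ (exp a₁ a₂ a₃ a₄ a₅ a₆) = exp a₁ a₂ a₃ a₄ (a₅ ℕ.∸ 1) a₆
lower 𝑡  (exp a₁ a₂ a₃ a₄ a₅ a₆) = exp a₁ a₂ a₃ a₄ a₅ (a₆ ℕ.∸ 1)

∂ : Var → Poly → Poly
∂ z = monoMap (exponent z) (lower z)

sumVars : (Var → Poly) → Poly
sumVars F = F 𝑢₁ ⊕ F 𝑢₂ ⊕ F 𝑢₃ ⊕ F 𝑣₁ ⊕ F 𝑣₂ ⊕ F 𝑡

ΣVar : (Var → ℚ) → ℚ
ΣVar F = F 𝑢₁ ℚ.+ F 𝑢₂ ℚ.+ F 𝑢₃ ℚ.+ F 𝑣₁ ℚ.+ F 𝑣₂ ℚ.+ F 𝑡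

exponent-addE : ∀ z f g → exponent z (addE f g) ≡ exponent z f ℚ.+ exponent z g
exponent-addE 𝑢₁ f g = qℕ-+ (eu1 f) (eu1 g)
exponent-addE 𝑢₂ f g = qℤ-+ (eu2 f) (eu2 g)
exponent-addE 𝑢₃ f g = qℕ-+ (eu3 f) (eu3 g)
exponent-addE 𝑣₁ f g = qℕ-+ (ev1 f) (ev1 g)
exponent-addE 𝑣₂ f g = qℕ-+ (ev2 f) (ev2 g)
exponent-addE 𝑡  f g = qℕ-+ (et f) (et g)

-- Truncated subtraction commutes with adding g unless the exponent of z in f is 0.
lower-addE : ∀ z f g → exponent z f ≡ 0ℚ ⊎ addE (lower z f) g ≡ lower z (addE f g)
lower-addE 𝑢₁ (exp zero _ _ _ _ _) g    = inj₁ refl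
lower-addE 𝑢₁ (exp (suc _) _ _ _ _ _) g = inj₂ refl
lower-addE 𝑢₂ (exp _ a₂ _ _ _ _) g      = inj₂ (cong (λ a → exp _ a _ _ _ _) (begin
    a₂ ℤ.- + 1 ℤ.+ eu2 g     ≡⟨ ℤₚ.+-assoc a₂ (ℤ.- + 1) (eu2 g) ⟩
    a₂ ℤ.+ (ℤ.- + 1 ℤ.+ eu2 g) ≡⟨ cong (λ b → a₂ ℤ.+ b) (ℤₚ.+-comm (ℤ.- + 1) (eu2 g)) ⟩
    a₂ ℤ.+ (eu2 g ℤ.- + 1)   ≡⟨ ℤₚ.+-assoc a₂ (eu2 g) (ℤ.- + 1) ⟨
    a₂ ℤ.+ eu2 g ℤ.- + 1     ∎))
  where open ≡-Reasoning
lower-addE 𝑢₃ (exp _ _ zero _ _ _) g    = inj₁ refl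
lower-addE 𝑢₃ (exp _ _ (suc _) _ _ _) g = inj₂ refl
lower-addE 𝑣₁ (exp _ _ _ zero _ _) g    = inj₁ refl
lower-addE 𝑣₁ (exp _ _ _ (suc _) _ _) g = inj₂ refl
lower-addE 𝑣₂ (exp _ _ _ _ zero _) g    = inj₁ refl
lower-addE 𝑣₂ (exp _ _ _ _ (suc _) _) g = inj₂ refl
lower-addE 𝑡  (exp _ _ _ _ _ zero) g    = inj₁ refl
lower-addE 𝑡  (exp _ _ _ _ _ (suc _)) g = inj₂ refl

*-δ-cong : ∀ e {k x y} → k ≡ 0ℚ ⊎ x ≡ y → k ℚ.* δ e x ≡ k ℚ.* δ e y
*-δ-cong e {x = x} {y} (inj₁ refl) = trans (ℚₚ.*-zeroˡ (δ e x)) (sym (ℚₚ.*-zeroˡ (δ e y)))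
*-δ-cong e (inj₂ refl) = refl

monoMap-Leibniz : ∀ k d → (∀ f g → k (addE f g) ≡ k f ℚ.+ k g) →
  (∀ f g → k f ≡ 0ℚ ⊎ addE (d f) g ≡ d (addE f g)) →
  ∀ p q → monoMap k d (p ⊗ q) ≋ monoMap k d p ⊗ q ⊕ p ⊗ monoMap k d q
monoMap-Leibniz k d k-additive d-shift p q = mk≋ λ e → begin
    coeff (monoMap k d (p ⊗ q)) e
  ≡⟨ coeff-monoMap k d (p ⊗ q) e ⟩
    lin (λ h → k h ℚ.* δ e (d h)) (p ⊗ q)
  ≡⟨ lin-⊗ _ p q ⟩
    lin (λ f → lin (λ g → k (addE f g) ℚ.* δ e (d (addE f g))) q) p
  ≡⟨ lin-cong (λ f → trans (lin-cong (pointwise e f) q) (lin-+ (L e f) (R e f) q)) p ⟩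
    lin (λ f → lin (L e f) q ℚ.+ lin (R e f) q) p
  ≡⟨ lin-+ (λ f → lin (L e f) q) (λ f → lin (R e f) q) p ⟩
    lin (λ f → lin (L e f) q) p ℚ.+ lin (λ f → lin (R e f) q) p
  ≡⟨ cong₂ ℚ._+_ (left e) (right e) ⟨
    coeff (monoMap k d p ⊗ q) e ℚ.+ coeff (p ⊗ monoMap k d q) e
  ≡⟨ coeff-++ (monoMap k d p ⊗ q) (p ⊗ monoMap k d q) e ⟨
    coeff (monoMap k d p ⊗ q ⊕ p ⊗ monoMap k d q) e
  ∎
  where
  open ≡-Reasoning
  L R : Exp → Exp → Exp → ℚ
  L e f g = k f ℚ.* δ e (addE (d f) g)
  R e f g = k g ℚ.* δ e (addE f (d g))
  pointwise : ∀ e f g → k (addE f g) ℚ.* δ e (d (addE f g)) ≡ L e f g ℚ.+ R e f g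
  pointwise e f g = begin
      k (addE f g) ℚ.* δ e (d (addE f g))
    ≡⟨ trans (cong (ℚ._* _) (k-additive f g)) (ℚₚ.*-distribʳ-+ _ (k f) (k g)) ⟩
      k f ℚ.* δ e (d (addE f g)) ℚ.+ k g ℚ.* δ e (d (addE f g))
    ≡⟨ cong₂ ℚ._+_ (*-δ-cong e (Sum.map₂ sym (d-shift f g)))
                   (*-δ-cong e (Sum.map₂ (λ eq → trans (cong d (addE-comm f g)) (trans (sym eq) (addE-comm (d g) f)))
                     (d-shift g f))) ⟩
      L e f g ℚ.+ R e f g
    ∎
  left : ∀ e → coeff (monoMap k d p ⊗ q) e ≡ lin (λ f → lin (L e f) q) p
  left e = begin
      coeff (monoMap k d p ⊗ q) e                                       ≡⟨ coeff-⊗ (monoMap k d p) q e ⟩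
      lin (λ f → lin (λ g → δ e (addE f g)) q) (monoMap k d p)          ≡⟨ lin-monoMap _ k d p ⟩
      lin (λ f → k f ℚ.* lin (λ g → δ e (addE (d f) g)) q) p            ≡⟨ lin-cong (λ f → lin-scale (k f) _ q) p ⟨
      lin (λ f → lin (L e f) q) p                                        ∎
  right : ∀ e → coeff (p ⊗ monoMap k d q) e ≡ lin (λ f → lin (R e f) q) p
  right e = trans (coeff-⊗ p (monoMap k d q) e) (lin-cong (λ f → lin-monoMap _ k d q) p)

∂-Leibniz : ∀ z p q → ∂ z (p ⊗ q) ≋ ∂ z p ⊗ q ⊕ p ⊗ ∂ z q
∂-Leibniz z = monoMap-Leibniz (exponent z) (lower z) (exponent-addE z) (lower-addE z)

sumVars-cong : ∀ {F G} → (∀ z → F z ≋ G z) → sumVars F ≋ sumVars G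
sumVars-cong F≋G =
  ⊕-cong (⊕-cong (⊕-cong (⊕-cong (⊕-cong (F≋G 𝑢₁) (F≋G 𝑢₂)) (F≋G 𝑢₃)) (F≋G 𝑣₁)) (F≋G 𝑣₂)) (F≋G 𝑡)

sumVars-Leibniz : ∀ F G p q → sumVars (λ z → F z ⊗ q ⊕ p ⊗ G z) ≋ sumVars F ⊗ q ⊕ p ⊗ sumVars G
sumVars-Leibniz F G p q = solve 14
  (λ a₁ a₂ a₃ a₄ a₅ a₆ b₁ b₂ b₃ b₄ b₅ b₆ p q →
     (a₁ :* q :+ p :* b₁) :+ (a₂ :* q :+ p :* b₂) :+ (a₃ :* q :+ p :* b₃)
       :+ (a₄ :* q :+ p :* b₄) :+ (a₅ :* q :+ p :* b₅) :+ (a₆ :* q :+ p :* b₆)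
     := (a₁ :+ a₂ :+ a₃ :+ a₄ :+ a₅ :+ a₆) :* q :+ p :* (b₁ :+ b₂ :+ b₃ :+ b₄ :+ b₅ :+ b₆))
  ≋-refl (F 𝑢₁) (F 𝑢₂) (F 𝑢₃) (F 𝑣₁) (F 𝑣₂) (F 𝑡)
         (G 𝑢₁) (G 𝑢₂) (G 𝑢₃) (G 𝑣₁) (G 𝑣₂) (G 𝑡) p q
  where open PolySolver

D-Leibniz : ∀ p q → D (p ⊗ q) ≋ D p ⊗ q ⊕ p ⊗ D q
D-Leibniz p q =
  ≋-trans (sumVars-cong λ z → ≋-trans (⊗-congˡ (grammar z) (∂-Leibniz z p q)) (regroup (grammar z) (∂ z p) (∂ z q)))
  (sumVars-Leibniz (λ z → grammar z ⊗ ∂ z p) (λ z → grammar z ⊗ ∂ z q) p q)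
  where
  open PolySolver
  regroup : ∀ g a b → g ⊗ (a ⊗ q ⊕ p ⊗ b) ≋ (g ⊗ a) ⊗ q ⊕ p ⊗ (g ⊗ b)
  regroup g a b = solve 5 (λ g a b p q → g :* (a :* q :+ p :* b) := (g :* a) :* q :+ p :* (g :* b)) ≋-refl g a b p q

lin-sumVars : ∀ φ F → lin φ (sumVars F) ≡ ΣVar (λ z → lin φ (F z))
lin-sumVars φ F
  rewrite lin-++ φ (F 𝑢₁ ⊕ F 𝑢₂ ⊕ F 𝑢₃ ⊕ F 𝑣₁ ⊕ F 𝑣₂) (F 𝑡)
        | lin-++ φ (F 𝑢₁ ⊕ F 𝑢₂ ⊕ F 𝑢₃ ⊕ F 𝑣₁) (F 𝑣₂)
        | lin-++ φ (F 𝑢₁ ⊕ F 𝑢₂ ⊕ F 𝑢₃) (F 𝑣₁)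
        | lin-++ φ (F 𝑢₁ ⊕ F 𝑢₂) (F 𝑢₃)
        | lin-++ φ (F 𝑢₁) (F 𝑢₂) = refl

lin-ΣVar : ∀ (φ : Var → Exp → ℚ) p → lin (λ f → ΣVar (λ z → φ z f)) p ≡ ΣVar (λ z → lin (φ z) p)
lin-ΣVar φ p
  rewrite lin-+ (λ f → φ 𝑢₁ f ℚ.+ φ 𝑢₂ f ℚ.+ φ 𝑢₃ f ℚ.+ φ 𝑣₁ f ℚ.+ φ 𝑣₂ f) (φ 𝑡) p
        | lin-+ (λ f → φ 𝑢₁ f ℚ.+ φ 𝑢₂ f ℚ.+ φ 𝑢₃ f ℚ.+ φ 𝑣₁ f) (φ 𝑣₂) p
        | lin-+ (λ f → φ 𝑢₁ f ℚ.+ φ 𝑢₂ f ℚ.+ φ 𝑢₃ f) (φ 𝑣₁) p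
        | lin-+ (λ f → φ 𝑢₁ f ℚ.+ φ 𝑢₂ f) (φ 𝑢₃) p | lin-+ (φ 𝑢₁) (φ 𝑢₂) p = refl

ΣVar-cong : ∀ {F G} → (∀ z → F z ≡ G z) → ΣVar F ≡ ΣVar G
ΣVar-cong F≡G rewrite F≡G 𝑢₁ | F≡G 𝑢₂ | F≡G 𝑢₃ | F≡G 𝑣₁ | F≡G 𝑣₂ | F≡G 𝑡 = refl

-- Dkernel e f is the coefficient of x^e in D(x^f).
Dkernel : Exp → Exp → ℚ
Dkernel e f = ΣVar λ z → lin (λ h → exponent z f ℚ.* δ e (addE h (lower z f))) (grammar z)

coeff-D : ∀ p e → coeff (D p) e ≡ lin (Dkernel e) p
coeff-D p e = begin
    coeff (D p) e
  ≡⟨ trans (coeff-lin (D p) e) (lin-sumVars (δ e) (λ z → grammar z ⊗ ∂ z p)) ⟩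
    ΣVar (λ z → lin (δ e) (grammar z ⊗ ∂ z p))
  ≡⟨ ΣVar-cong (λ z → trans (sym (coeff-lin (grammar z ⊗ ∂ z p) e)) (coeff-⊗∂ z)) ⟩
    ΣVar (λ z → lin (λ f → lin (λ h → exponent z f ℚ.* δ e (addE h (lower z f))) (grammar z)) p)
  ≡⟨ lin-ΣVar (λ z f → lin (λ h → exponent z f ℚ.* δ e (addE h (lower z f))) (grammar z)) p ⟨
    lin (Dkernel e) p
  ∎
  where
  open ≡-Reasoning
  coeff-⊗∂ : ∀ z → coeff (grammar z ⊗ ∂ z p) e ≡
    lin (λ f → lin (λ h → exponent z f ℚ.* δ e (addE h (lower z f))) (grammar z)) p
  coeff-⊗∂ z = trans (coeff-⊗ (grammar z) (∂ z p) e)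
    (trans (lin-cong (λ h → lin-monoMap (λ f → δ e (addE h f)) (exponent z) (lower z) p) (grammar z))
      (lin-swap (λ h f → exponent z f ℚ.* δ e (addE h (lower z f))) (grammar z) p))

deg : Exp → ℕ
deg f = eu1 f ℕ.+ eu3 f ℕ.+ ev2 f ℕ.+ et f

degVar : Var → ℕ
degVar 𝑢₂ = 0
degVar 𝑣₁ = 0
degVar _  = 1

deg-addE : ∀ f g → deg (addE f g) ≡ deg f ℕ.+ deg g
deg-addE (exp a₁ _ a₃ _ a₅ a₆) (exp b₁ _ b₃ _ b₅ b₆) =
  solve 8 (λ a₁ a₃ a₅ a₆ b₁ b₃ b₅ b₆ → (a₁ :+ b₁) :+ (a₃ :+ b₃) :+ (a₅ :+ b₅) :+ (a₆ :+ b₆)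
                                      := (a₁ :+ a₃ :+ a₅ :+ a₆) :+ (b₁ :+ b₃ :+ b₅ :+ b₆))
    refl a₁ a₃ a₅ a₆ b₁ b₃ b₅ b₆
  where open ℕSolver.+-*-Solver

deg-lower : ∀ z f → exponent z f ≡ 0ℚ ⊎ degVar z ℕ.+ deg (lower z f) ≡ deg f
deg-lower 𝑢₁ (exp zero _ _ _ _ _) = inj₁ refl
deg-lower 𝑢₁ (exp (suc _) _ _ _ _ _) = inj₂ refl
deg-lower 𝑢₂ (exp _ _ _ _ _ _) = inj₂ refl
deg-lower 𝑢₃ (exp _ _ zero _ _ _) = inj₁ refl
deg-lower 𝑢₃ (exp a₁ _ (suc a₃) _ a₅ a₆) = inj₂ (cong (λ n → n ℕ.+ a₅ ℕ.+ a₆) (sym (ℕₚ.+-suc a₁ a₃)))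
deg-lower 𝑣₁ (exp _ _ _ _ _ _) = inj₂ refl
deg-lower 𝑣₂ (exp _ _ _ _ zero _) = inj₁ refl
deg-lower 𝑣₂ (exp a₁ _ a₃ _ (suc a₅) a₆) = inj₂ (cong (ℕ._+ a₆) (sym (ℕₚ.+-suc (a₁ ℕ.+ a₃) a₅)))
deg-lower 𝑡 (exp _ _ _ _ _ zero) = inj₁ refl
deg-lower 𝑡 (exp a₁ _ a₃ _ a₅ (suc a₆)) = inj₂ (sym (ℕₚ.+-suc (a₁ ℕ.+ a₃ ℕ.+ a₅) a₆))

grammar-homogeneous : ∀ z → All (λ t → deg (proj₂ t) ≡ suc (degVar z)) (grammar z)
grammar-homogeneous 𝑢₁ = refl ∷ []
grammar-homogeneous 𝑢₂ = refl ∷ []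
grammar-homogeneous 𝑢₃ = refl ∷ []
grammar-homogeneous 𝑣₁ = refl ∷ refl ∷ []
grammar-homogeneous 𝑣₂ = refl ∷ []
grammar-homogeneous 𝑡  = refl ∷ []

δ-vanish : ∀ e f → deg f ≢ deg e → δ e f ≡ 0ℚ
δ-vanish e f deg≢ with f ≟E e
... | yes refl = ⊥-elim (deg≢ refl)
... | no _     = refl

Dkernel-vanish : ∀ e f → suc (deg f) ≢ deg e → Dkernel e f ≡ 0ℚ
Dkernel-vanish e f deg≢ = ΣVar-cong {G = λ _ → 0ℚ} λ z →
  lin-vanish {φ = λ h → exponent z f ℚ.* δ e (addE h (lower z f))} (grammar z) (All.map (λ {t} → term-vanish z {t}) (grammar-homogeneous z))
  where
  term-vanish : ∀ z {t : Term} → deg (proj₂ t) ≡ suc (degVar z) →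
    exponent z f ℚ.* δ e (addE (proj₂ t) (lower z f)) ≡ 0ℚ
  term-vanish z {_ , h} deg-h with deg-lower z f
  ... | inj₁ k≡0 = trans (cong (ℚ._* δ e (addE h (lower z f))) k≡0) (ℚₚ.*-zeroˡ (δ e (addE h (lower z f))))
  ... | inj₂ deg-f = trans (cong (exponent z f ℚ.*_) (δ-vanish e (addE h (lower z f)) λ eq → deg≢ (begin
          suc (deg f)                          ≡⟨ cong suc deg-f ⟨
          suc (degVar z) ℕ.+ deg (lower z f)   ≡⟨ cong (ℕ._+ deg (lower z f)) deg-h ⟨
          deg h ℕ.+ deg (lower z f)            ≡⟨ deg-addE h (lower z f) ⟨
          deg (addE h (lower z f))             ≡⟨ eq ⟩
          deg e                                ∎)))
        (ℚₚ.*-zeroʳ (exponent z f))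
    where open ≡-Reasoning

D-homogeneous : ∀ p q e → (∀ f → suc (deg f) ≡ deg e → coeff p f ≡ coeff q f) → coeff (D p) e ≡ coeff (D q) e
D-homogeneous p q e agree = trans (coeff-D p e) (trans (lin-resp p q agree′) (sym (coeff-D q e)))
  where
  agree′ : ∀ f → Dkernel e f ≡ 0ℚ ⊎ coeff p f ≡ coeff q f
  agree′ f with suc (deg f) ℕ.≟ deg e
  ... | yes eq = inj₂ (agree f eq)
  ... | no neq = inj₁ (Dkernel-vanish e f neq)

lin-· : ∀ φ k p → lin φ (k · p) ≡ k ℚ.* lin φ p
lin-· φ k p = trans (lin-monoMap φ (λ _ → k) (λ f → f) p) (lin-scale k φ p)

D-· : ∀ k p → D (k · p) ≋ k · D p
D-· k p = mk≋ λ e → begin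
  coeff (D (k · p)) e         ≡⟨ coeff-D (k · p) e ⟩
  lin (Dkernel e) (k · p)     ≡⟨ lin-· (Dkernel e) k p ⟩
  k ℚ.* lin (Dkernel e) p     ≡⟨ cong (k ℚ.*_) (coeff-D p e) ⟨
  k ℚ.* coeff (D p) e         ≡⟨ coeff-· k (D p) e ⟨
  coeff (k · D p) e           ∎
  where open ≡-Reasoning

D-⊕ : ∀ p q → D (p ⊕ q) ≋ D p ⊕ D q
D-⊕ p q = mk≋ λ e → begin
  coeff (D (p ⊕ q)) e                       ≡⟨ coeff-D (p ⊕ q) e ⟩
  lin (Dkernel e) (p ++ q)                  ≡⟨ lin-++ (Dkernel e) p q ⟩
  lin (Dkernel e) p ℚ.+ lin (Dkernel e) q   ≡⟨ cong₂ ℚ._+_ (coeff-D p e) (coeff-D q e) ⟨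
  coeff (D p) e ℚ.+ coeff (D q) e           ≡⟨ coeff-++ (D p) (D q) e ⟨
  coeff (D p ⊕ D q) e                       ∎
  where open ≡-Reasoning

D-cong : ∀ {p q} → p ≋ q → D p ≋ D q
D-cong {p} {q} p≋q = mk≋ λ e → D-homogeneous p q e λ f _ → coeff≡ p≋q f

euler : Poly → Poly
euler = monoMap (λ f → qℕ (deg f)) (λ f → f)

euler-Leibniz : ∀ p q → euler (p ⊗ q) ≋ euler p ⊗ q ⊕ p ⊗ euler q
euler-Leibniz = monoMap-Leibniz (λ f → qℕ (deg f)) (λ f → f)
  (λ f g → trans (cong qℕ (deg-addE f g)) (qℕ-+ (deg f) (deg g))) (λ _ _ → inj₂ refl)

coeff-euler : ∀ p e → coeff (euler p) e ≡ qℕ (deg e) ℚ.* coeff p e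
coeff-euler p e = begin
  coeff (euler p) e                     ≡⟨ coeff-monoMap (λ f → qℕ (deg f)) (λ f → f) p e ⟩
  lin (λ f → qℕ (deg f) ℚ.* δ e f) p    ≡⟨ lin-cong on-support p ⟩
  lin (λ f → qℕ (deg e) ℚ.* δ e f) p    ≡⟨ lin-scale (qℕ (deg e)) (δ e) p ⟩
  qℕ (deg e) ℚ.* lin (δ e) p            ≡⟨ cong (qℕ (deg e) ℚ.*_) (coeff-lin p e) ⟨
  qℕ (deg e) ℚ.* coeff p e              ∎
  where
  open ≡-Reasoning
  on-support : ∀ f → qℕ (deg f) ℚ.* δ e f ≡ qℕ (deg e) ℚ.* δ e f
  on-support f with f ≟E e
  ... | yes refl = refl
  ... | no _     = trans (ℚₚ.*-zeroʳ (qℕ (deg f))) (sym (ℚₚ.*-zeroʳ (qℕ (deg e))))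

euler-⊕ : ∀ p q → euler (p ⊕ q) ≡ euler p ⊕ euler q
euler-⊕ p q = Listₚ.map-++ _ p q

Δ : Poly → Poly
Δ p = D p ⊖ euler p

coeff-Δ : ∀ p e → coeff (Δ p) e ≡ coeff (D p) e ℚ.- qℕ (deg e) ℚ.* coeff p e
coeff-Δ p e = trans (coeff-⊖ (D p) (euler p) e) (cong (λ x → coeff (D p) e ℚ.- x) (coeff-euler p e))

Δ-Leibniz : ∀ p q → Δ (p ⊗ q) ≋ Δ p ⊗ q ⊕ p ⊗ Δ q
Δ-Leibniz p q = ≋-trans (⊕-cong (D-Leibniz p q) (neg-cong (euler-Leibniz p q)))
  (solve 6 (λ Dp Dq Ep Eq p q → (Dp :* q :+ p :* Dq) :- (Ep :* q :+ p :* Eq) := (Dp :- Ep) :* q :+ p :* (Dq :- Eq))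
    ≋-refl (D p) (D q) (euler p) (euler q) p q)
  where open PolySolver

Δ-⊕ : ∀ p q → Δ (p ⊕ q) ≋ Δ p ⊕ Δ q
Δ-⊕ p q = ≋-trans (⊕-cong (D-⊕ p q) (neg-cong (≋-reflexive (euler-⊕ p q))))
  (solve 4 (λ Dp Dq Ep Eq → (Dp :+ Dq) :- (Ep :+ Eq) := (Dp :- Ep) :+ (Dq :- Eq)) ≋-refl (D p) (D q) (euler p) (euler q))
  where open PolySolver

exps : Poly → List Exp
exps = map proj₂

coeff-∉ : ∀ p e → ¬ e ∈ exps p → coeff p e ≡ 0ℚ
coeff-∉ [] e _ = refl
coeff-∉ ((c , f) ∷ p) e e∉ with f ≟E e
... | yes refl = ⊥-elim (e∉ (here refl))
... | no _     = coeff-∉ p e (λ e∈ → e∉ (there e∈))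

-- On closed polynomials the check evaluates to tt, so decide-≋ _ _ _ proves their equality.
decide-≋ : ∀ p q → True (all? (λ e → coeff p e ℚₚ.≟ coeff q e) (exps p ++ exps q)) → p ≋ q
decide-≋ p q check = mk≋ λ e → at e
  where
  at : ∀ e → coeff p e ≡ coeff q e
  at e with e ∈? (exps p ++ exps q)
  ... | yes e∈ = All.lookup (toWitness check) e∈
  ... | no e∉  = trans (coeff-∉ p e (λ e∈ → e∉ (∈-++⁺ˡ e∈))) (sym (coeff-∉ q e (λ e∈ → e∉ (∈-++⁺ʳ (exps p) e∈))))

Δ-1 : Δ 1P ≋ []
Δ-1 = decide-≋ _ _ _

Δ-t : Δ t ≋ t ⊗ t ⊗ v1 ⊕ neg t
Δ-t = decide-≋ _ _ _

Δ-u1 : Δ u1 ≋ const (qℕ 3) ⊗ t ⊗ u2 ⊗ v2 ⊕ neg u1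
Δ-u1 = decide-≋ _ _ _

Δ-u3 : Δ u3 ≋ const (qℕ 3) ⊗ t ⊗ u2 ⊗ v2 ⊕ neg u3
Δ-u3 = decide-≋ _ _ _

Δ-v1 : Δ v1 ≋ const (qℕ 2) ⊗ (u1 ⊕ u3)
Δ-v1 = decide-≋ _ _ _

Δ-u2v2 : Δ (u2 ⊗ v2) ≋ const (qℕ 3) ⊗ t ⊗ u2 ⊗ v1 ⊗ v2 ⊕ const (qℕ 4) ⊗ u1 ⊗ u3 ⊕ neg (u2 ⊗ v2)
Δ-u2v2 = decide-≋ _ _ _

-- Agreement in low degrees

infix 4 _≈[_]_
record _≈[_]_ (p : Poly) (k : ℕ) (q : Poly) : Set where
  constructor mk≈[]
  field agree : ∀ e → deg e < k → coeff p e ≡ coeff q e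
open _≈[_]_ public

≋⇒≈[] : ∀ {k p q} → p ≋ q → p ≈[ k ] q
≋⇒≈[] p≋q = mk≈[] λ e _ → coeff≡ p≋q e

≈[]-setoid : ℕ → Setoid _ _
≈[]-setoid k = record
  { Carrier = Poly
  ; _≈_ = _≈[ k ]_
  ; isEquivalence = record
    { refl = mk≈[] λ _ _ → refl
    ; sym = λ p≈q → mk≈[] λ e e< → sym (agree p≈q e e<)
    ; trans = λ p≈q q≈r → mk≈[] λ e e< → trans (agree p≈q e e<) (agree q≈r e e<) } }

module ≈[]-Reasoning (k : ℕ) = SetoidReasoning (≈[]-setoid k)

≈[]-refl : ∀ {k p} → p ≈[ k ] p
≈[]-refl {k} = Setoid.refl (≈[]-setoid k)

≈[]-sym : ∀ {k p q} → p ≈[ k ] q → q ≈[ k ] p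
≈[]-sym {k} = Setoid.sym (≈[]-setoid k)

≈[]-trans : ∀ {k p q r} → p ≈[ k ] q → q ≈[ k ] r → p ≈[ k ] r
≈[]-trans {k} = Setoid.trans (≈[]-setoid k)

≈[]-weaken : ∀ {j k p q} → j ≤ k → p ≈[ k ] q → p ≈[ j ] q
≈[]-weaken j≤k p≈q = mk≈[] λ e e< → agree p≈q e (ℕₚ.<-≤-trans e< j≤k)

≈[]-⊕ : ∀ {k p p′ q q′} → p ≈[ k ] p′ → q ≈[ k ] q′ → p ⊕ q ≈[ k ] p′ ⊕ q′
≈[]-⊕ {p = p} {p′} {q} {q′} p≈p′ q≈q′ = mk≈[] λ e e< →
  trans (coeff-++ p q e) (trans (cong₂ ℚ._+_ (agree p≈p′ e e<) (agree q≈q′ e e<)) (sym (coeff-++ p′ q′ e)))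

≈[]-⊕ˡ : ∀ {k} p {q q′} → q ≈[ k ] q′ → p ⊕ q ≈[ k ] p ⊕ q′
≈[]-⊕ˡ p = ≈[]-⊕ (≈[]-refl {p = p})

MinDeg : ℕ → Poly → Set
MinDeg j s = All (λ t → j ≤ deg (proj₂ t)) s

≈[]-vanish : ∀ {k} p → MinDeg k p → p ≈[ k ] []
≈[]-vanish {k} p high = mk≈[] λ e e< → trans (coeff-lin p e)
  (lin-vanish p (All.map (λ {t} k≤ → δ-vanish e (proj₂ t) λ eq → ℕₚ.<⇒≱ e< (subst (k ≤_) eq k≤)) high))

deg-addE-mono : ∀ {j k} f g → j ≤ deg f → k ≤ deg g → j ℕ.+ k ≤ deg (addE f g)
deg-addE-mono {j} {k} f g j≤ k≤ = subst (j ℕ.+ k ≤_) (sym (deg-addE f g)) (ℕₚ.+-mono-≤ j≤ k≤)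

≈[]-shift : ∀ {j k p q} s → MinDeg j s → p ≈[ k ] q → s ⊗ p ≈[ j ℕ.+ k ] s ⊗ q
≈[]-shift {j} {k} {p} {q} s high p≈q = mk≈[] λ e e< → begin
    coeff (s ⊗ p) e                                    ≡⟨ coeff-⊗ s p e ⟩
    lin (λ f → lin (λ g → δ e (addE f g)) p) s         ≡⟨ lin-cong-on s (All.map (λ {t} → inner e e< {t}) high) ⟩
    lin (λ f → lin (λ g → δ e (addE f g)) q) s         ≡⟨ coeff-⊗ s q e ⟨
    coeff (s ⊗ q) e                                    ∎
  where
  open ≡-Reasoning
  inner : ∀ e → deg e < j ℕ.+ k → ∀ {t : Term} → j ≤ deg (proj₂ t) →
    lin (λ g → δ e (addE (proj₂ t) g)) p ≡ lin (λ g → δ e (addE (proj₂ t) g)) q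
  inner e e< {_ , f} j≤ = lin-resp p q λ g → case-deg g
    where
    case-deg : ∀ g → δ e (addE f g) ≡ 0ℚ ⊎ coeff p g ≡ coeff q g
    case-deg g with deg g ℕ.<? k
    ... | yes g< = inj₂ (agree p≈q g g<)
    ... | no g≮  = inj₁ (δ-vanish e (addE f g) λ eq →
      ℕₚ.<⇒≱ e< (subst (j ℕ.+ k ≤_) eq (deg-addE-mono f g j≤ (ℕₚ.≮⇒≥ g≮))))

≈[]-⊗ : ∀ {k p p′ q q′} → p ≈[ k ] p′ → q ≈[ k ] q′ → p ⊗ q ≈[ k ] p′ ⊗ q′
≈[]-⊗ {p = p} {p′} {q} {q′} p≈p′ q≈q′ =
  ≈[]-trans (≈[]-shift p (All.universal (λ _ → z≤n) p) q≈q′) (≈[]-trans (≋⇒≈[] (⊗-comm p q′))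
  (≈[]-trans (≈[]-shift q′ (All.universal (λ _ → z≤n) q′) p≈p′) (≋⇒≈[] (⊗-comm q′ p′))))

≈[]-⊗ˡ : ∀ {k} p {q q′} → q ≈[ k ] q′ → p ⊗ q ≈[ k ] p ⊗ q′
≈[]-⊗ˡ p = ≈[]-⊗ (≈[]-refl {p = p})

≈[]-⊗ʳ : ∀ {k p p′} → p ≈[ k ] p′ → ∀ q → p ⊗ q ≈[ k ] p′ ⊗ q
≈[]-⊗ʳ p≈p′ q = ≈[]-⊗ p≈p′ (≈[]-refl {p = q})

Δ-resp : ∀ {k p q} → p ≈[ k ] q → Δ p ≈[ k ] Δ q
Δ-resp {k} {p} {q} p≈q = mk≈[] λ e e< → begin
    coeff (Δ p) e                                   ≡⟨ coeff-Δ p e ⟩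
    coeff (D p) e ℚ.- qℕ (deg e) ℚ.* coeff p e      ≡⟨ cong₂ (λ a b → a ℚ.- qℕ (deg e) ℚ.* b)
                                                          (D-homogeneous p q e (below e e<)) (agree p≈q e e<) ⟩
    coeff (D q) e ℚ.- qℕ (deg e) ℚ.* coeff q e      ≡⟨ coeff-Δ q e ⟨
    coeff (Δ q) e                                   ∎
  where
  open ≡-Reasoning
  below : ∀ e → deg e < k → ∀ f → suc (deg f) ≡ deg e → coeff p f ≡ coeff q f
  below e e< f eq = agree p≈q f (ℕₚ.<-trans (ℕₚ.n<1+n (deg f)) (subst (_< k) (sym eq) e<))

-- The functional equations of the generating functions

2· : Poly → Poly
2· p = const (qℕ 2) ⊗ p

-- Generating functions of the second child and of a younger child of a vertex, given the
-- generating function N of the non-leaf trees.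
secondGF youngerGF : Poly → Poly
secondGF N = u2 ⊗ v2 ⊕ u3 ⊗ N
youngerGF N = v1 ⊕ N

κ : Poly → Poly
κ N = t ⊗ t ⊗ v1 ⊗ youngerGF N ⊖ t ⊗ v1 ⊕ 2· (t ⊗ u3)

t-MinDeg : MinDeg 1 t
t-MinDeg = s≤s z≤n ∷ []

≈[]-difference : ∀ {k p q} → p ≈[ k ] q → p ⊖ q ≈[ k ] []
≈[]-difference {q = q} p≈q = ≈[]-trans (≈[]-⊕ p≈q ≈[]-refl) (≋⇒≈[] (neg-inverseʳ q))

≈[]-cancel : ∀ {k} w v r → r ≈[ k ] [] → w ⊕ v ⊗ r ≈[ k ] w
≈[]-cancel w v r r≈0 = ≈[]-trans (≈[]-⊕ (≈[]-refl {p = w}) (≈[]-⊗ (≈[]-refl {p = v}) r≈0))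
  (≋⇒≈[] (≋-trans (⊕-cong (≋-refl {w}) (⊗-comm v [])) (⊕-identityʳ w)))

Δ-Leibniz₃ : ∀ a b c → Δ (a ⊗ b ⊗ c) ≋ Δ a ⊗ b ⊗ c ⊕ a ⊗ (Δ b ⊗ c ⊕ b ⊗ Δ c)
Δ-Leibniz₃ a b c = begin
  Δ (a ⊗ b ⊗ c)                                  ≈⟨ Δ-Leibniz (a ⊗ b) c ⟩
  Δ (a ⊗ b) ⊗ c ⊕ (a ⊗ b) ⊗ Δ c                  ≈⟨ ⊕-cong (⊗-cong (Δ-Leibniz a b) ≋-refl) ≋-refl ⟩
  (Δ a ⊗ b ⊕ a ⊗ Δ b) ⊗ c ⊕ (a ⊗ b) ⊗ Δ c        ≈⟨ solve 6 (λ a b c Δa Δb Δc → (Δa :* b :+ a :* Δb) :* c :+ (a :* b) :* Δc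
                                                              := Δa :* b :* c :+ a :* (Δb :* c :+ b :* Δc))
                                                      ≋-refl a b c (Δ a) (Δ b) (Δ c) ⟩
  Δ a ⊗ b ⊗ c ⊕ a ⊗ (Δ b ⊗ c ⊕ b ⊗ Δ c)          ∎
  where
  open ≋-Reasoning
  open PolySolver

module FunctionalEquations (N A : Poly) where

  forestDefect treeDefect : Poly
  forestDefect = A ⊖ (1P ⊕ t ⊗ youngerGF N ⊗ A)
  treeDefect = N ⊖ (u1 ⊕ t ⊗ secondGF N ⊗ A)

  α β : Poly
  α = neg (t ⊗ t ⊗ v1 ⊗ secondGF N ⊗ A ⊕ const (qℕ 3) ⊗ t ⊗ u2 ⊗ v2)
  β = neg (2· (t ⊗ u3 ⊗ A) ⊕ 1P)

  Δ-forestRHS : Δ (1P ⊕ t ⊗ youngerGF N ⊗ A) ≋ Δ t ⊗ youngerGF N ⊗ A ⊕ t ⊗ ((Δ v1 ⊕ Δ N) ⊗ A ⊕ youngerGF N ⊗ Δ A)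
  Δ-forestRHS = begin
    Δ (1P ⊕ t ⊗ youngerGF N ⊗ A)                        ≈⟨ Δ-⊕ 1P (t ⊗ youngerGF N ⊗ A) ⟩
    Δ 1P ⊕ Δ (t ⊗ youngerGF N ⊗ A)                     ≈⟨ ⊕-cong Δ-1 (Δ-Leibniz₃ t (youngerGF N) A) ⟩
    [] ⊕ (Δ t ⊗ youngerGF N ⊗ A ⊕ t ⊗ (Δ (v1 ⊕ N) ⊗ A ⊕ youngerGF N ⊗ Δ A))
      ≈⟨ ⊕-congˡ (Δ t ⊗ youngerGF N ⊗ A) (⊗-congˡ t (⊕-congʳ (⊗-congʳ (Δ-⊕ v1 N) A) (youngerGF N ⊗ Δ A))) ⟩
    Δ t ⊗ youngerGF N ⊗ A ⊕ t ⊗ ((Δ v1 ⊕ Δ N) ⊗ A ⊕ youngerGF N ⊗ Δ A) ∎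
    where open ≋-Reasoning

  Δ-treeRHS : Δ (u1 ⊕ t ⊗ secondGF N ⊗ A) ≋
    Δ u1 ⊕ (Δ t ⊗ secondGF N ⊗ A ⊕ t ⊗ ((Δ (u2 ⊗ v2) ⊕ (Δ u3 ⊗ N ⊕ u3 ⊗ Δ N)) ⊗ A ⊕ secondGF N ⊗ Δ A))
  Δ-treeRHS = begin
    Δ (u1 ⊕ t ⊗ secondGF N ⊗ A)                          ≈⟨ Δ-⊕ u1 (t ⊗ secondGF N ⊗ A) ⟩
    Δ u1 ⊕ Δ (t ⊗ secondGF N ⊗ A)                       ≈⟨ ⊕-congˡ (Δ u1) (Δ-Leibniz₃ t (secondGF N) A) ⟩
    Δ u1 ⊕ (Δ t ⊗ secondGF N ⊗ A ⊕ t ⊗ (Δ (secondGF N) ⊗ A ⊕ secondGF N ⊗ Δ A))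
      ≈⟨ ⊕-congˡ (Δ u1) (⊕-congˡ (Δ t ⊗ secondGF N ⊗ A) (⊗-congˡ t (⊕-congʳ (⊗-congʳ ΔQ A) (secondGF N ⊗ Δ A)))) ⟩
    Δ u1 ⊕ (Δ t ⊗ secondGF N ⊗ A ⊕ t ⊗ ((Δ (u2 ⊗ v2) ⊕ (Δ u3 ⊗ N ⊕ u3 ⊗ Δ N)) ⊗ A ⊕ secondGF N ⊗ Δ A)) ∎
    where
    open ≋-Reasoning
    ΔQ : Δ (secondGF N) ≋ Δ (u2 ⊗ v2) ⊕ (Δ u3 ⊗ N ⊕ u3 ⊗ Δ N)
    ΔQ = ≋-trans (Δ-⊕ (u2 ⊗ v2) (u3 ⊗ N)) (⊕-congˡ (Δ (u2 ⊗ v2)) (Δ-Leibniz u3 N))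

  -- The last step of each is a ring identity, whose multipliers (κ N ⊗ A, α, β) come from
  -- substituting t (v1 + N) A = A − 1 − forestDefect and t (u2 v2 + u3 N) A = N − u1 − treeDefect.
  module Step {k} (ΔN≈ : Δ N ≈[ k ] N ⊖ 2· u1) (ΔA≈ : Δ A ≈[ k ] κ N ⊗ A ⊗ A) where

    ΔA-step : Δ (1P ⊕ t ⊗ youngerGF N ⊗ A) ≈[ suc k ] κ N ⊗ A ⊗ A ⊕ neg (κ N ⊗ A) ⊗ forestDefect
    ΔA-step = begin
        Δ (1P ⊕ t ⊗ youngerGF N ⊗ A)
      ≈⟨ ≋⇒≈[] Δ-forestRHS ⟩
        Δ t ⊗ youngerGF N ⊗ A ⊕ t ⊗ ((Δ v1 ⊕ Δ N) ⊗ A ⊕ youngerGF N ⊗ Δ A)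
      ≈⟨ ≈[]-⊕ˡ (Δ t ⊗ youngerGF N ⊗ A) (≈[]-shift t t-MinDeg
           (≈[]-⊕ (≈[]-⊗ʳ (≈[]-⊕ˡ (Δ v1) ΔN≈) A) (≈[]-⊗ˡ (youngerGF N) ΔA≈))) ⟩
        Δ t ⊗ youngerGF N ⊗ A ⊕ t ⊗ ((Δ v1 ⊕ (N ⊖ 2· u1)) ⊗ A ⊕ youngerGF N ⊗ (κ N ⊗ A ⊗ A))
      ≈⟨ ≋⇒≈[] (⊕-cong (⊗-congʳ (⊗-congʳ Δ-t (youngerGF N)) A)
           (⊗-congˡ t (⊕-congʳ (⊗-congʳ (⊕-congʳ Δ-v1 (N ⊖ 2· u1)) A) (youngerGF N ⊗ (κ N ⊗ A ⊗ A))))) ⟩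
        (t ⊗ t ⊗ v1 ⊖ t) ⊗ youngerGF N ⊗ A ⊕ t ⊗ ((2· (u1 ⊕ u3) ⊕ (N ⊖ 2· u1)) ⊗ A ⊕ youngerGF N ⊗ (κ N ⊗ A ⊗ A))
      ≈⟨ ≋⇒≈[] (solve 6 (λ t v1 u1 u3 N A →
           let C = v1 :+ N
               K = t :* t :* v1 :* C :- t :* v1 :+ con (qℕ 2) :* (t :* u3)
           in (t :* t :* v1 :- t) :* C :* A :+ t :* ((con (qℕ 2) :* (u1 :+ u3) :+ (N :- con (qℕ 2) :* u1)) :* A :+ C :* (K :* A :* A))
              := K :* A :* A :+ (:- (K :* A)) :* (A :- (con 1ℚ :+ t :* C :* A)))
           ≋-refl t v1 u1 u3 N A) ⟩
        κ N ⊗ A ⊗ A ⊕ neg (κ N ⊗ A) ⊗ forestDefect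
      ∎
      where
      open ≈[]-Reasoning (suc k)
      open PolySolver

    ΔN-step : Δ (u1 ⊕ t ⊗ secondGF N ⊗ A) ≈[ suc k ] N ⊖ 2· u1 ⊕ α ⊗ forestDefect ⊕ β ⊗ treeDefect
    ΔN-step = begin
        Δ (u1 ⊕ t ⊗ secondGF N ⊗ A)
      ≈⟨ ≋⇒≈[] Δ-treeRHS ⟩
        Δ u1 ⊕ (Δ t ⊗ secondGF N ⊗ A ⊕ t ⊗ ((Δ (u2 ⊗ v2) ⊕ (Δ u3 ⊗ N ⊕ u3 ⊗ Δ N)) ⊗ A ⊕ secondGF N ⊗ Δ A))
      ≈⟨ ≈[]-⊕ˡ (Δ u1) (≈[]-⊕ˡ (Δ t ⊗ secondGF N ⊗ A) (≈[]-shift t t-MinDeg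
           (≈[]-⊕ (≈[]-⊗ʳ (≈[]-⊕ˡ (Δ (u2 ⊗ v2)) (≈[]-⊕ˡ (Δ u3 ⊗ N) (≈[]-⊗ˡ u3 ΔN≈))) A)
                  (≈[]-⊗ˡ (secondGF N) ΔA≈)))) ⟩
        Δ u1 ⊕ (Δ t ⊗ secondGF N ⊗ A ⊕ t ⊗ ((Δ (u2 ⊗ v2) ⊕ (Δ u3 ⊗ N ⊕ u3 ⊗ (N ⊖ 2· u1))) ⊗ A
                                            ⊕ secondGF N ⊗ (κ N ⊗ A ⊗ A)))
      ≈⟨ ≋⇒≈[] (⊕-cong Δ-u1 (⊕-cong (⊗-congʳ (⊗-congʳ Δ-t (secondGF N)) A) (⊗-congˡ t (⊕-congʳ (⊗-congʳ
           (⊕-cong Δ-u2v2 (⊕-congʳ (⊗-congʳ Δ-u3 N) (u3 ⊗ (N ⊖ 2· u1)))) A) (secondGF N ⊗ (κ N ⊗ A ⊗ A)))))) ⟩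
        (const (qℕ 3) ⊗ t ⊗ u2 ⊗ v2 ⊖ u1) ⊕ ((t ⊗ t ⊗ v1 ⊖ t) ⊗ secondGF N ⊗ A ⊕ t ⊗
          (((const (qℕ 3) ⊗ t ⊗ u2 ⊗ v1 ⊗ v2 ⊕ const (qℕ 4) ⊗ u1 ⊗ u3 ⊖ u2 ⊗ v2)
            ⊕ ((const (qℕ 3) ⊗ t ⊗ u2 ⊗ v2 ⊖ u3) ⊗ N ⊕ u3 ⊗ (N ⊖ 2· u1))) ⊗ A ⊕ secondGF N ⊗ (κ N ⊗ A ⊗ A)))
      ≈⟨ ≋⇒≈[] (solve 8 (λ t u1 u2 u3 v1 v2 N A →
           let C = v1 :+ N
               Q = u2 :* v2 :+ u3 :* N
               K = t :* t :* v1 :* C :- t :* v1 :+ con (qℕ 2) :* (t :* u3)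
           in (con (qℕ 3) :* t :* u2 :* v2 :- u1) :+ ((t :* t :* v1 :- t) :* Q :* A :+ t :*
                (((con (qℕ 3) :* t :* u2 :* v1 :* v2 :+ con (qℕ 4) :* u1 :* u3 :- u2 :* v2)
                  :+ ((con (qℕ 3) :* t :* u2 :* v2 :- u3) :* N :+ u3 :* (N :- con (qℕ 2) :* u1))) :* A :+ Q :* (K :* A :* A)))
              := N :- con (qℕ 2) :* u1 :+ (:- (t :* t :* v1 :* Q :* A :+ con (qℕ 3) :* t :* u2 :* v2)) :* (A :- (con 1ℚ :+ t :* C :* A))
                 :+ (:- (con (qℕ 2) :* (t :* u3 :* A) :+ con 1ℚ)) :* (N :- (u1 :+ t :* Q :* A)))
           ≋-refl t u1 u2 u3 v1 v2 N A) ⟩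
        N ⊖ 2· u1 ⊕ α ⊗ forestDefect ⊕ β ⊗ treeDefect
      ∎
      where
      open ≈[]-Reasoning (suc k)
      open PolySolver

  module _ {K} (forest : A ≈[ K ] 1P ⊕ t ⊗ youngerGF N ⊗ A) (tree : N ≈[ K ] u1 ⊕ t ⊗ secondGF N ⊗ A) where

    -- Both functional equations are used up to degree k+1, the induction hypothesis only up to k,
    -- because Δ N and Δ A enter the expansions multiplied by t.
    Δ-solution : ∀ k → k ≤ K → Δ N ≈[ k ] N ⊖ 2· u1 × Δ A ≈[ k ] κ N ⊗ A ⊗ A
    Δ-solution zero _ = mk≈[] (λ _ ()) , mk≈[] (λ _ ())
    Δ-solution (suc k) k<K = ΔN≈ , ΔA≈
      where
      open Step (proj₁ (Δ-solution k (ℕₚ.<⇒≤ k<K))) (proj₂ (Δ-solution k (ℕₚ.<⇒≤ k<K)))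
      forest′ = ≈[]-weaken k<K forest
      tree′ = ≈[]-weaken k<K tree
      ΔA≈ : Δ A ≈[ suc k ] κ N ⊗ A ⊗ A
      ΔA≈ = begin
        Δ A                                          ≈⟨ Δ-resp forest′ ⟩
        Δ (1P ⊕ t ⊗ youngerGF N ⊗ A)                ≈⟨ ΔA-step ⟩
        κ N ⊗ A ⊗ A ⊕ neg (κ N ⊗ A) ⊗ forestDefect      ≈⟨ ≈[]-cancel (κ N ⊗ A ⊗ A) (neg (κ N ⊗ A)) forestDefect
                                                                        (≈[]-difference forest′) ⟩
        κ N ⊗ A ⊗ A                                  ∎
        where open ≈[]-Reasoning (suc k)
      ΔN≈ : Δ N ≈[ suc k ] N ⊖ 2· u1
      ΔN≈ = begin
        Δ N                                          ≈⟨ Δ-resp tree′ ⟩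
        Δ (u1 ⊕ t ⊗ secondGF N ⊗ A)                 ≈⟨ ΔN-step ⟩
        N ⊖ 2· u1 ⊕ α ⊗ forestDefect ⊕ β ⊗ treeDefect        ≈⟨ ≈[]-cancel (N ⊖ 2· u1 ⊕ α ⊗ forestDefect) β treeDefect
                                                                          (≈[]-difference tree′) ⟩
        N ⊖ 2· u1 ⊕ α ⊗ forestDefect                     ≈⟨ ≈[]-cancel (N ⊖ 2· u1) α forestDefect (≈[]-difference forest′) ⟩
        N ⊖ 2· u1                                    ∎
        where open ≈[]-Reasoning (suc k)

-- Enumerating tip-augmented trees

leaf : Tree
leaf = node []

fork : Tree → List Tree → Tree
fork c f = node (leaf ∷ c ∷ f)

-- trees B contains every tip-augmented tree with at most B edges (and some larger ones);
-- forests B every list f of such trees with length f + edgesL f ≤ B, i.e. the possible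
-- younger children (from the third on) of a vertex.
mutual
  trees : ℕ → List Tree
  trees B = leaf ∷ nonLeafTrees B

  nonLeafTrees : ℕ → List Tree
  nonLeafTrees zero    = []
  nonLeafTrees (suc B) = node (leaf ∷ []) ∷ cartesianProductWith fork (trees B) (forests B)

  forests : ℕ → List (List Tree)
  forests zero    = [] ∷ []
  forests (suc B) = [] ∷ cartesianProductWith _∷_ (trees B) (forests B)

nonLeafTrees-shape : ∀ B {T} → T ∈ nonLeafTrees B → ∃ λ cs → T ≡ node (leaf ∷ cs)
nonLeafTrees-shape (suc B) (here refl) = [] , refl
nonLeafTrees-shape (suc B) (there T∈) with ∈-cartesianProductWith⁻ fork (trees B) (forests B) T∈
... | c , f , _ , _ , refl = c ∷ f , refl

mutual
  trees-tipAug : ∀ B {T} → T ∈ trees B → tipAug T ≡ true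
  trees-tipAug B (here refl) = refl
  trees-tipAug B (there T∈)  = nonLeafTrees-tipAug B T∈

  nonLeafTrees-tipAug : ∀ B {T} → T ∈ nonLeafTrees B → tipAug T ≡ true
  nonLeafTrees-tipAug (suc B) (here refl) = refl
  nonLeafTrees-tipAug (suc B) (there T∈) with ∈-cartesianProductWith⁻ fork (trees B) (forests B) T∈
  ... | c , f , c∈ , f∈ , refl = cong₂ _∧_ (trees-tipAug B c∈) (forests-tipAug B f∈)

  forests-tipAug : ∀ B {f} → f ∈ forests B → tipAugL f ≡ true
  forests-tipAug zero    (here refl) = refl
  forests-tipAug (suc B) (here refl) = refl
  forests-tipAug (suc B) (there f∈) with ∈-cartesianProductWith⁻ _∷_ (trees B) (forests B) f∈
  ... | c , f , c∈ , f∈ , refl = cong₂ _∧_ (trees-tipAug B c∈) (forests-tipAug B f∈)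

isLeaf⇒≡leaf : ∀ c → isLeaf c ≡ true → c ≡ leaf
isLeaf⇒≡leaf (node []) _ = refl

≤-split : ∀ a b c {n} → a + (b + c) ≤ n → b ≤ n × a + c ≤ n
≤-split a b c a+b+c≤n =
  ℕₚ.≤-trans (ℕₚ.≤-trans (ℕₚ.m≤m+n b c) (ℕₚ.m≤n+m (b + c) a)) a+b+c≤n ,
  ℕₚ.≤-trans (ℕₚ.+-monoʳ-≤ a (ℕₚ.m≤n+m c b)) a+b+c≤n

mutual
  trees-complete : ∀ B T → tipAug T ≡ true → edges T ≤ B → T ∈ trees B
  trees-complete B (node []) _ _ = here refl
  trees-complete B (node (c ∷ cs)) ta size with isLeaf⇒≡leaf c (∧-conicalˡ (isLeaf c) _ ta)
  ... | refl = there (nonLeafTrees-complete B cs (∧-conicalʳ true _ ta) size)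

  nonLeafTrees-complete : ∀ B cs → tipAugL (leaf ∷ cs) ≡ true → edges (node (leaf ∷ cs)) ≤ B →
    node (leaf ∷ cs) ∈ nonLeafTrees B
  nonLeafTrees-complete (suc B) [] _ _ = here refl
  nonLeafTrees-complete (suc B) (c ∷ f) ta (s≤s size) = there (∈-cartesianProductWith⁺ fork
    (trees-complete B c (∧-conicalˡ (tipAug c) _ ta′) (proj₁ split))
    (forests-complete B f (∧-conicalʳ (tipAug c) _ ta′) (ℕₚ.≤-trans (ℕₚ.n≤1+n _) (proj₂ split))))
    where
    ta′ = ∧-conicalʳ true (tipAugL (c ∷ f)) ta
    split = ≤-split (suc (length f)) (edges c) (edgesL f) size

  forests-complete : ∀ B f → tipAugL f ≡ true → length f + edgesL f ≤ B → f ∈ forests B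
  forests-complete zero    [] _ _ = here refl
  forests-complete (suc B) [] _ _ = here refl
  forests-complete (suc B) (c ∷ f) ta (s≤s size) = there (∈-cartesianProductWith⁺ _∷_
    (trees-complete B c (∧-conicalˡ (tipAug c) _ ta) (proj₁ split))
    (forests-complete B f (∧-conicalʳ (tipAug c) _ ta) (proj₂ split)))
    where split = ≤-split (length f) (edges c) (edgesL f) size

fork-injective : ∀ {c c′ f f′} → fork c f ≡ fork c′ f′ → c ≡ c′ × f ≡ f′
fork-injective refl = refl , refl

∷-injective : ∀ {c c′ : Tree} {f f′ : List Tree} → List._∷_ c f ≡ c′ ∷ f′ → c ≡ c′ × f ≡ f′
∷-injective refl = refl , refl

mutual
  trees-unique : ∀ B → Unique (trees B)
  trees-unique B = All.tabulate (λ T∈ leaf≡T → leaf≢nonLeaf (nonLeafTrees-shape B T∈) leaf≡T) ∷ nonLeafTrees-unique B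
    where
    leaf≢nonLeaf : ∀ {T} → (∃ λ cs → T ≡ node (leaf ∷ cs)) → leaf ≢ T
    leaf≢nonLeaf (_ , refl) ()

  nonLeafTrees-unique : ∀ B → Unique (nonLeafTrees B)
  nonLeafTrees-unique zero    = []
  nonLeafTrees-unique (suc B) =
    All.tabulate (λ T∈ → cherry≢fork (∈-cartesianProductWith⁻ fork (trees B) (forests B) T∈))
    ∷ Uniqueₚ.cartesianProductWith⁺ fork fork-injective (trees-unique B) (forests-unique B)
    where
    cherry≢fork : ∀ {T} → (∃ λ c → ∃ λ f → c ∈ trees B × f ∈ forests B × T ≡ fork c f) → node (leaf ∷ []) ≢ T
    cherry≢fork (_ , _ , _ , _ , refl) ()

  forests-unique : ∀ B → Unique (forests B)
  forests-unique zero    = [] ∷ []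
  forests-unique (suc B) =
    All.tabulate (λ f∈ → []≢∷ (∈-cartesianProductWith⁻ _∷_ (trees B) (forests B) f∈))
    ∷ Uniqueₚ.cartesianProductWith⁺ _∷_ ∷-injective (trees-unique B) (forests-unique B)
    where
    []≢∷ : ∀ {g} → (∃ λ c → ∃ λ f → c ∈ trees B × f ∈ forests B × g ≡ c ∷ f) → [] ≢ g
    []≢∷ (_ , _ , _ , _ , refl) ()

lin-↭ : ∀ φ {p q} → p ↭ q → lin φ p ≡ lin φ q
lin-↭ φ ↭.refl = refl
lin-↭ φ (↭.prep (c , f) p↭q) = cong (c ℚ.* φ f ℚ.+_) (lin-↭ φ p↭q)
lin-↭ φ {q = _ ∷ _ ∷ q} (↭.swap (c , f) (d , g) p↭q) = trans (cong (λ r → c ℚ.* φ f ℚ.+ (d ℚ.* φ g ℚ.+ r)) (lin-↭ φ p↭q))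
  (solve 3 (λ a b r → a :+ (b :+ r) := b :+ (a :+ r)) refl (c ℚ.* φ f) (d ℚ.* φ g) (lin φ q))
  where open ℚSolver.+-*-Solver
lin-↭ φ (↭.trans p↭q q↭r) = trans (lin-↭ φ p↭q) (lin-↭ φ q↭r)

-- Two duplicate-free enumerations of the same set of trees are permutations of each other.
enumerations-agree : ∀ {m xs ys} → Unique xs → IsTipAugEnum m xs → Unique ys → IsTipAugEnum m ys → Msum xs ≋ Msum ys
enumerations-agree {xs = xs} {ys} xs! xs-enum ys! ys-enum = mk≋ λ e →
  trans (coeff-lin (Msum xs) e) (trans (lin-↭ (δ e) (↭ₚ.map⁺ weight xs↭ys)) (sym (coeff-lin (Msum ys) e)))
  where
  move : ∀ {zs ws m} → IsTipAugEnum m zs → IsTipAugEnum m ws → ∀ {T} → T ∈ zs → T ∈ ws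
  move zs-enum ws-enum {T} T∈ = let (ta , size) = proj₁ (zs-enum T) T∈ in proj₂ (ws-enum T) ta size
  xs↭ys : xs ↭ ys
  xs↭ys = ∼bag⇒↭ (unique∧set⇒bag xs! ys! (mk⇔ (move xs-enum ys-enum) (move ys-enum xs-enum)))

statsDeg : Stats → ℕ
statsDeg s = sleaf s ℕ.+ entleaf s ℕ.+ syleaf s ℕ.+ yedge s

statsDeg-+S : ∀ s s′ → statsDeg (s +S s′) ≡ statsDeg s ℕ.+ statsDeg s′
statsDeg-+S (stats a _ c d _ f) (stats a′ _ c′ d′ _ f′) =
  solve 8 (λ a c d f a′ c′ d′ f′ → (a :+ a′) :+ (c :+ c′) :+ (d :+ d′) :+ (f :+ f′)
                                  := (a :+ c :+ d :+ f) :+ (a′ :+ c′ :+ d′ :+ f′))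
    refl a c d f a′ c′ d′ f′
  where open ℕSolver.+-*-Solver

statsDeg-younger : ∀ cs → statsDeg (younger cs) ≡ length cs
statsDeg-younger [] = refl
statsDeg-younger (c ∷ cs) = trans (statsDeg-+S (stats 0 0 0 0 (b2n (isLeaf c)) 1) (younger cs)) (cong suc (statsDeg-younger cs))

statsDeg-top : ∀ {c} cs → c ≡ leaf → statsDeg (top (c ∷ cs)) ≡ length (c ∷ cs)
statsDeg-top [] refl = refl
statsDeg-top (node [] ∷ cs) refl =
  trans (statsDeg-+S (stats 0 1 0 0 0 0 +S stats 0 0 0 1 0 1) (younger cs)) (cong (2 ℕ.+_) (statsDeg-younger cs))
statsDeg-top (node (_ ∷ _) ∷ cs) refl =
  trans (statsDeg-+S (stats 0 0 1 0 0 0 +S stats 0 0 0 0 0 1) (younger cs)) (cong (2 ℕ.+_) (statsDeg-younger cs))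

mutual
  statsDeg-tree : ∀ T → tipAug T ≡ true → statsDeg (treeStats T) ≡ edges T
  statsDeg-tree (node []) _ = refl
  statsDeg-tree (node (c ∷ cs)) ta = trans (statsDeg-+S (top (c ∷ cs)) (treeStatsL (c ∷ cs)))
    (cong₂ ℕ._+_ (statsDeg-top cs (isLeaf⇒≡leaf c (∧-conicalˡ (isLeaf c) _ ta)))
                 (statsDeg-forest (c ∷ cs) (∧-conicalʳ (isLeaf c) _ ta)))

  statsDeg-forest : ∀ cs → tipAugL cs ≡ true → statsDeg (treeStatsL cs) ≡ edgesL cs
  statsDeg-forest [] _ = refl
  statsDeg-forest (c ∷ cs) ta = trans (statsDeg-+S (treeStats c) (treeStatsL cs))
    (cong₂ ℕ._+_ (statsDeg-tree c (∧-conicalˡ (tipAug c) _ ta)) (statsDeg-forest cs (∧-conicalʳ (tipAug c) _ ta)))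

coeff-off-degree : ∀ p e → All (λ t → deg (proj₂ t) ≢ deg e) p → coeff p e ≡ 0ℚ
coeff-off-degree p e off = trans (coeff-lin p e) (lin-vanish p (All.map (λ {t} → δ-vanish e (proj₂ t)) off))

coeff-Msum-∷ : ∀ T xs e → coeff (Msum (T ∷ xs)) e ≡ coeff (weight T ∷ []) e ℚ.+ coeff (Msum xs) e
coeff-Msum-∷ T xs e = coeff-++ (weight T ∷ []) (Msum xs) e

coeff-Msum-filter : ∀ m e xs → deg e ≡ m → All (λ T → tipAug T ≡ true) xs →
  coeff (Msum xs) e ≡ coeff (Msum (filter (λ T → edges T ℕ.≟ m) xs)) e
coeff-Msum-filter m e [] _ [] = refl
coeff-Msum-filter m e (T ∷ xs) deg-e (ta ∷ tas) with edges T ℕ.≟ m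
... | yes edges≡m = begin
    coeff (Msum (T ∷ xs)) e                       ≡⟨ coeff-Msum-∷ T xs e ⟩
    w ℚ.+ coeff (Msum xs) e                       ≡⟨ cong (w ℚ.+_) (coeff-Msum-filter m e xs deg-e tas) ⟩
    w ℚ.+ coeff (Msum (filter edges≟m xs)) e      ≡⟨ coeff-Msum-∷ T (filter edges≟m xs) e ⟨
    coeff (Msum (T ∷ filter edges≟m xs)) e        ≡⟨ cong (λ ys → coeff (Msum ys) e) (Listₚ.filter-accept edges≟m {T} {xs} edges≡m) ⟨
    coeff (Msum (filter edges≟m (T ∷ xs))) e      ∎
  where
  open ≡-Reasoning
  edges≟m = λ T → edges T ℕ.≟ m
  w = coeff (weight T ∷ []) e
... | no edges≢m = begin
    coeff (Msum (T ∷ xs)) e                       ≡⟨ coeff-Msum-∷ T xs e ⟩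
    w ℚ.+ coeff (Msum xs) e                       ≡⟨ cong (ℚ._+ coeff (Msum xs) e) w≡0 ⟩
    0ℚ ℚ.+ coeff (Msum xs) e                      ≡⟨ ℚₚ.+-identityˡ (coeff (Msum xs) e) ⟩
    coeff (Msum xs) e                             ≡⟨ coeff-Msum-filter m e xs deg-e tas ⟩
    coeff (Msum (filter edges≟m xs)) e            ≡⟨ cong (λ ys → coeff (Msum ys) e) (Listₚ.filter-reject edges≟m {T} {xs} edges≢m) ⟨
    coeff (Msum (filter edges≟m (T ∷ xs))) e      ∎
  where
  open ≡-Reasoning
  edges≟m = λ T → edges T ℕ.≟ m
  w = coeff (weight T ∷ []) e
  w≡0 : w ≡ 0ℚ
  w≡0 = coeff-off-degree (weight T ∷ []) e ((λ eq → edges≢m (trans (sym (statsDeg-tree T ta)) (trans eq deg-e))) ∷ [])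

treeGF : ℕ → Poly
treeGF B = Msum (nonLeafTrees B)

slice : ℕ → ℕ → List Tree
slice m B = filter (λ T → edges T ℕ.≟ m) (nonLeafTrees B)

slice-unique : ∀ m B → Unique (slice m B)
slice-unique m B = Uniqueₚ.filter⁺ (λ T → edges T ℕ.≟ m) (nonLeafTrees-unique B)

slice-enumerates : ∀ {m B} → 1 ≤ m → m ≤ B → IsTipAugEnum m (slice m B)
slice-enumerates {m} {B} 1≤m m≤B T = sound , complete
  where
  sound : T ∈ slice m B → tipAug T ≡ true × edges T ≡ m
  sound T∈ = let (T∈′ , edges≡m) = ∈-filter⁻ (λ T → edges T ℕ.≟ m) T∈ in nonLeafTrees-tipAug B T∈′ , edges≡m
  complete : tipAug T ≡ true → edges T ≡ m → T ∈ slice m B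
  complete ta edges≡m with trees-complete B T ta (subst (_≤ B) (sym edges≡m) m≤B)
  ... | here refl = ⊥-elim (ℕₚ.<⇒≢ 1≤m edges≡m)
  ... | there T∈ = ∈-filter⁺ (λ T → edges T ℕ.≟ m) T∈ edges≡m

coeff-treeGF : ∀ {m B xs} e → 1 ≤ m → m ≤ B → Unique xs → IsTipAugEnum m xs → deg e ≡ m →
  coeff (treeGF B) e ≡ coeff (Msum xs) e
coeff-treeGF {m} {B} {xs} e 1≤m m≤B xs! xs-enum deg-e =
  trans (coeff-Msum-filter m e (nonLeafTrees B) deg-e (All.tabulate (nonLeafTrees-tipAug B)))
    (coeff≡ (enumerations-agree (slice-unique m B) (slice-enumerates 1≤m m≤B) xs! xs-enum) e)

-- Generating functions

sumOver : {A : Set} → (A → Poly) → List A → Poly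
sumOver F [] = []
sumOver F (x ∷ xs) = F x ⊕ sumOver F xs

sumOver-++ : {A : Set} (F : A → Poly) → ∀ xs ys → sumOver F (xs ++ ys) ≋ sumOver F xs ⊕ sumOver F ys
sumOver-++ F [] ys = ≋-refl
sumOver-++ F (x ∷ xs) ys = ≋-trans (⊕-congˡ (F x) (sumOver-++ F xs ys)) (≋-sym (⊕-assoc (F x) (sumOver F xs) (sumOver F ys)))

sumOver-cong : {A : Set} {F G : A → Poly} → ∀ xs → All (λ x → F x ≋ G x) xs → sumOver F xs ≋ sumOver G xs
sumOver-cong [] [] = ≋-refl
sumOver-cong (x ∷ xs) (F≋G ∷ h) = ⊕-cong F≋G (sumOver-cong xs h)

sumOver-⊗ˡ : {A : Set} (p : Poly) (F : A → Poly) → ∀ xs → sumOver (λ x → p ⊗ F x) xs ≋ p ⊗ sumOver F xs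
sumOver-⊗ˡ p F [] = ⊗-comm [] p
sumOver-⊗ˡ p F (x ∷ xs) = ≋-trans (⊕-congˡ (p ⊗ F x) (sumOver-⊗ˡ p F xs)) (≋-sym (⊗-distribˡ p (F x) (sumOver F xs)))

sumOver-cartesian : {A B C : Set} (H : C → Poly) (g : A → B → C) (F : A → Poly) (G : B → Poly) →
  (∀ x y → H (g x y) ≋ F x ⊗ G y) → ∀ xs ys → sumOver H (cartesianProductWith g xs ys) ≋ sumOver F xs ⊗ sumOver G ys
sumOver-cartesian H g F G H≋ [] ys = ≋-refl
sumOver-cartesian H g F G H≋ (x ∷ xs) ys = begin
    sumOver H (map (g x) ys ++ cartesianProductWith g xs ys)
  ≈⟨ sumOver-++ H (map (g x) ys) (cartesianProductWith g xs ys) ⟩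
    sumOver H (map (g x) ys) ⊕ sumOver H (cartesianProductWith g xs ys)
  ≈⟨ ⊕-cong (row ys) (sumOver-cartesian H g F G H≋ xs ys) ⟩
    F x ⊗ sumOver G ys ⊕ sumOver F xs ⊗ sumOver G ys
  ≈⟨ ⊗-distribʳ (sumOver G ys) (F x) (sumOver F xs) ⟨
    (F x ⊕ sumOver F xs) ⊗ sumOver G ys
  ∎
  where
  open ≋-Reasoning
  row : ∀ ys → sumOver H (map (g x) ys) ≋ F x ⊗ sumOver G ys
  row ys = ≋-trans (sumOver-cong-map ys) (sumOver-⊗ˡ (F x) G ys)
    where
    sumOver-cong-map : ∀ ys → sumOver H (map (g x) ys) ≋ sumOver (λ y → F x ⊗ G y) ys
    sumOver-cong-map [] = ≋-refl
    sumOver-cong-map (y ∷ ys) = ⊕-cong (H≋ x y) (sumOver-cong-map ys)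

monomial : Stats → Poly
monomial s = (1ℚ , exp (sleaf s) (+ etleaf s) (entleaf s) (yerleaf s) (syleaf s) (yedge s)) ∷ []

-- The factors of the weight of fork c f contributed by its younger children f (with their
-- subtrees and edges), and by the second child c; youngerMonomial c is c's factor, without
-- its edge, in the forestMonomial of a list headed by c.
forestMonomial : List Tree → Poly
forestMonomial f = monomial (younger f +S treeStatsL f)

secondMonomial : Tree → Poly
secondMonomial (node [])        = u2 ⊗ v2
secondMonomial c@(node (_ ∷ _)) = u3 ⊗ monomial (treeStats c)

youngerMonomial : Tree → Poly
youngerMonomial (node [])        = v1
youngerMonomial c@(node (_ ∷ _)) = monomial (treeStats c)

fork-monomial : ∀ c f → monomial (treeStats (fork c f)) ≋ t ⊗ secondMonomial c ⊗ forestMonomial f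
fork-monomial (node []) f =
  solve 5 (λ u2 v2 t y l → (u2 :* (v2 :* t) :* y) :* (con 1ℚ :* (con 1ℚ :* l)) := t :* (u2 :* v2) :* (y :* l))
    ≋-refl u2 v2 t (monomial (younger f)) (monomial (treeStatsL f))
  where open PolySolver
fork-monomial c@(node (_ ∷ _)) f =
  solve 5 (λ u3 t y w l → (u3 :* t :* y) :* (con 1ℚ :* (w :* l)) := t :* (u3 :* w) :* (y :* l))
    ≋-refl u3 t (monomial (younger f)) (monomial (treeStats c)) (monomial (treeStatsL f))
  where open PolySolver

forestMonomial-∷ : ∀ c f → forestMonomial (c ∷ f) ≋ t ⊗ youngerMonomial c ⊗ forestMonomial f
forestMonomial-∷ (node []) f =
  solve 4 (λ v1 t y l → (v1 :* t :* y) :* (con 1ℚ :* l) := t :* v1 :* (y :* l))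
    ≋-refl v1 t (monomial (younger f)) (monomial (treeStatsL f))
  where open PolySolver
forestMonomial-∷ c@(node (_ ∷ _)) f =
  solve 4 (λ t y w l → (t :* y) :* (w :* l) := t :* w :* (y :* l))
    ≋-refl t (monomial (younger f)) (monomial (treeStats c)) (monomial (treeStatsL f))
  where open PolySolver

forestGF : ℕ → Poly
forestGF B = sumOver forestMonomial (forests B)

Msum-sumOver : ∀ xs → Msum xs ≡ sumOver (λ T → monomial (treeStats T)) xs
Msum-sumOver [] = refl
Msum-sumOver (T ∷ xs) = cong (weight T ∷_) (Msum-sumOver xs)

sumOver-secondMonomial : ∀ B → sumOver secondMonomial (trees B) ≋ secondGF (treeGF B)
sumOver-secondMonomial B = ⊕-congˡ (u2 ⊗ v2) (begin
    sumOver secondMonomial (nonLeafTrees B)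
  ≈⟨ sumOver-cong (nonLeafTrees B) (All.tabulate λ T∈ → nonLeaf (nonLeafTrees-shape B T∈)) ⟩
    sumOver (λ T → u3 ⊗ monomial (treeStats T)) (nonLeafTrees B)
  ≈⟨ sumOver-⊗ˡ u3 (λ T → monomial (treeStats T)) (nonLeafTrees B) ⟩
    u3 ⊗ sumOver (λ T → monomial (treeStats T)) (nonLeafTrees B)
  ≡⟨ cong (u3 ⊗_) (Msum-sumOver (nonLeafTrees B)) ⟨
    u3 ⊗ treeGF B
  ∎)
  where
  open ≋-Reasoning
  nonLeaf : ∀ {T} → (∃ λ cs → T ≡ node (leaf ∷ cs)) → secondMonomial T ≋ u3 ⊗ monomial (treeStats T)
  nonLeaf (_ , refl) = ≋-refl

sumOver-youngerMonomial : ∀ B → sumOver youngerMonomial (trees B) ≋ youngerGF (treeGF B)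
sumOver-youngerMonomial B = ⊕-congˡ v1 (≋-trans
  (sumOver-cong (nonLeafTrees B) (All.tabulate λ T∈ → nonLeaf (nonLeafTrees-shape B T∈)))
  (≋-reflexive (sym (Msum-sumOver (nonLeafTrees B)))))
  where
  nonLeaf : ∀ {T} → (∃ λ cs → T ≡ node (leaf ∷ cs)) → youngerMonomial T ≋ monomial (treeStats T)
  nonLeaf (_ , refl) = ≋-refl

treeGF-suc : ∀ B → treeGF (suc B) ≋ u1 ⊕ t ⊗ secondGF (treeGF B) ⊗ forestGF B
treeGF-suc B = ⊕-congˡ u1 (begin
    Msum (cartesianProductWith fork (trees B) (forests B))
  ≡⟨ Msum-sumOver (cartesianProductWith fork (trees B) (forests B)) ⟩
    sumOver (λ T → monomial (treeStats T)) (cartesianProductWith fork (trees B) (forests B))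
  ≈⟨ sumOver-cartesian _ fork (λ c → t ⊗ secondMonomial c) forestMonomial fork-monomial (trees B) (forests B) ⟩
    sumOver (λ c → t ⊗ secondMonomial c) (trees B) ⊗ forestGF B
  ≈⟨ ⊗-congʳ (≋-trans (sumOver-⊗ˡ t secondMonomial (trees B)) (⊗-congˡ t (sumOver-secondMonomial B))) (forestGF B) ⟩
    t ⊗ secondGF (treeGF B) ⊗ forestGF B
  ∎)
  where open ≋-Reasoning

forestGF-suc : ∀ B → forestGF (suc B) ≋ 1P ⊕ t ⊗ youngerGF (treeGF B) ⊗ forestGF B
forestGF-suc B = ⊕-congˡ 1P (begin
    sumOver forestMonomial (cartesianProductWith _∷_ (trees B) (forests B))
  ≈⟨ sumOver-cartesian forestMonomial _∷_ (λ c → t ⊗ youngerMonomial c) forestMonomial forestMonomial-∷ (trees B) (forests B) ⟩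
    sumOver (λ c → t ⊗ youngerMonomial c) (trees B) ⊗ forestGF B
  ≈⟨ ⊗-congʳ (≋-trans (sumOver-⊗ˡ t youngerMonomial (trees B)) (⊗-congˡ t (sumOver-youngerMonomial B))) (forestGF B) ⟩
    t ⊗ youngerGF (treeGF B) ⊗ forestGF B
  ∎)
  where open ≋-Reasoning

≈[]-recursion : ∀ {k} c {X X′ Y Y′} → X ≈[ k ] X′ → Y ≈[ k ] Y′ → c ⊕ t ⊗ X ⊗ Y ≈[ suc k ] c ⊕ t ⊗ X′ ⊗ Y′
≈[]-recursion {k} c {X} {X′} {Y} {Y′} X≈ Y≈ = ≈[]-⊕ˡ c (begin
  t ⊗ X ⊗ Y        ≈⟨ ≋⇒≈[] (⊗-assoc t X Y) ⟩
  t ⊗ (X ⊗ Y)      ≈⟨ ≈[]-shift t t-MinDeg (≈[]-⊗ X≈ Y≈) ⟩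
  t ⊗ (X′ ⊗ Y′)    ≈⟨ ≋⇒≈[] (⊗-assoc t X′ Y′) ⟨
  t ⊗ X′ ⊗ Y′      ∎)
  where open ≈[]-Reasoning (suc k)

generatingFunctions-stable : ∀ B → treeGF (suc B) ≈[ suc B ] treeGF B × forestGF (suc B) ≈[ suc B ] forestGF B
generatingFunctions-stable zero =
  ≈[]-vanish (treeGF 1) (s≤s z≤n ∷ s≤s z≤n ∷ []) ,
  ≈[]-⊕ˡ 1P (≈[]-vanish (sumOver forestMonomial (cartesianProductWith _∷_ (trees 0) (forests 0))) (s≤s z≤n ∷ []))
generatingFunctions-stable (suc B) =
  ≈[]-trans (≋⇒≈[] (treeGF-suc (suc B))) (≈[]-trans
    (≈[]-recursion u1 (≈[]-⊕ˡ (u2 ⊗ v2) (≈[]-⊗ˡ u3 N-stable)) A-stable) (≋⇒≈[] (≋-sym (treeGF-suc B)))) ,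
  ≈[]-trans (≋⇒≈[] (forestGF-suc (suc B))) (≈[]-trans
    (≈[]-recursion 1P (≈[]-⊕ˡ v1 N-stable) A-stable) (≋⇒≈[] (≋-sym (forestGF-suc B))))
  where
  N-stable = proj₁ (generatingFunctions-stable B)
  A-stable = proj₂ (generatingFunctions-stable B)

module _ (B : ℕ) where
  private
    N = treeGF (suc B)
    A = forestGF (suc B)
    N-stable = ≈[]-weaken (ℕₚ.n≤1+n B) (≈[]-sym (proj₁ (generatingFunctions-stable B)))
    A-stable = ≈[]-weaken (ℕₚ.n≤1+n B) (≈[]-sym (proj₂ (generatingFunctions-stable B)))

  forestGF-equation : A ≈[ suc B ] 1P ⊕ t ⊗ youngerGF N ⊗ A
  forestGF-equation = ≈[]-trans (≋⇒≈[] (forestGF-suc B)) (≈[]-recursion 1P (≈[]-⊕ˡ v1 N-stable) A-stable)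

  treeGF-equation : N ≈[ suc B ] u1 ⊕ t ⊗ secondGF N ⊗ A
  treeGF-equation = ≈[]-trans (≋⇒≈[] (treeGF-suc B))
    (≈[]-recursion u1 (≈[]-⊕ˡ (u2 ⊗ v2) (≈[]-⊗ˡ u3 N-stable)) A-stable)

  Δ-treeGF : Δ N ≈[ suc B ] N ⊖ 2· u1
  Δ-treeGF = proj₁ (FunctionalEquations.Δ-solution N A forestGF-equation treeGF-equation (suc B) ℕₚ.≤-refl)

-- The recursion for D^n (2 u3)

Msum-homogeneous : ∀ {m xs} → IsTipAugEnum m xs → All (λ t → deg (proj₂ t) ≡ m) (Msum xs)
Msum-homogeneous {m} {xs} xs-enum = Allₚ.map⁺ (All.tabulate λ {T} T∈ →
  let (ta , edges≡m) = proj₁ (xs-enum T) T∈ in trans (statsDeg-tree T ta) edges≡m)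

D-Msum : ∀ {m xs ys} → 1 ≤ m → Unique xs → IsTipAugEnum m xs → Unique ys → IsTipAugEnum (suc m) ys →
  D (Msum xs) ≋ qℕ (m + 2) · Msum ys
D-Msum {m} {xs} {ys} 1≤m xs! xs-enum ys! ys-enum = mk≋ λ e → at e (deg e ℕ.≟ suc m)
  where
  N = treeGF (suc (suc m))
  off-degree : ∀ {k zs} → IsTipAugEnum k zs → ∀ f → deg f ≢ k → coeff (Msum zs) f ≡ 0ℚ
  off-degree zs-enum f deg-f≢ = coeff-off-degree _ f (All.map (λ eq eq′ → deg-f≢ (trans (sym eq′) eq)) (Msum-homogeneous zs-enum))
  on-degree : ∀ e → deg e ≡ suc m → coeff (D (Msum xs)) e ≡ coeff (qℕ (m + 2) · Msum ys) e
  on-degree e deg-e = begin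
      coeff (D (Msum xs)) e
    ≡⟨ D-homogeneous (Msum xs) N e (λ f eq →
         sym (coeff-treeGF f 1≤m (ℕₚ.m≤n+m m 2) xs! xs-enum (ℕₚ.suc-injective (trans eq deg-e)))) ⟩
      coeff (D N) e
    ≡⟨ solve 2 (λ d x → d := (d :- x) :+ x) refl (coeff (D N) e) (qℕ (deg e) ℚ.* coeff N e) ⟩
      (coeff (D N) e ℚ.- qℕ (deg e) ℚ.* coeff N e) ℚ.+ qℕ (deg e) ℚ.* coeff N e
    ≡⟨ cong₂ (λ x d → x ℚ.+ qℕ d ℚ.* coeff N e) (sym (coeff-Δ N e)) deg-e ⟩
      coeff (Δ N) e ℚ.+ qℕ (suc m) ℚ.* coeff N e
    ≡⟨ cong (ℚ._+ qℕ (suc m) ℚ.* coeff N e) (agree (Δ-treeGF (suc m)) e (subst (_< suc (suc m)) (sym deg-e) ℕₚ.≤-refl)) ⟩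
      coeff (N ⊖ 2· u1) e ℚ.+ qℕ (suc m) ℚ.* coeff N e
    ≡⟨ cong (ℚ._+ qℕ (suc m) ℚ.* coeff N e) (trans (coeff-⊖ N (2· u1) e) (cong (λ x → coeff N e ℚ.- x) u1-absent)) ⟩
      coeff N e ℚ.- 0ℚ ℚ.+ qℕ (suc m) ℚ.* coeff N e
    ≡⟨ solve 2 (λ x q → x :- con 0ℚ :+ q :* x := (q :+ con 1ℚ) :* x) refl (coeff N e) (qℕ (suc m)) ⟩
      (qℕ (suc m) ℚ.+ 1ℚ) ℚ.* coeff N e
    ≡⟨ cong₂ ℚ._*_ (sym (trans (cong qℕ (ℕₚ.+-suc m 1)) (qℕ-+ (suc m) 1)))
                   (coeff-treeGF e (s≤s z≤n) (ℕₚ.n≤1+n (suc m)) ys! ys-enum deg-e) ⟩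
      qℕ (m + 2) ℚ.* coeff (Msum ys) e
    ≡⟨ coeff-· (qℕ (m + 2)) (Msum ys) e ⟨
      coeff (qℕ (m + 2) · Msum ys) e
    ∎
    where
    open ≡-Reasoning
    open ℚSolver.+-*-Solver
    u1-absent : coeff (2· u1) e ≡ 0ℚ
    u1-absent = coeff-off-degree (2· u1) e ((λ eq → ℕₚ.<⇒≢ (s≤s 1≤m) (trans eq deg-e)) ∷ [])
  at : ∀ e → Dec (deg e ≡ suc m) → coeff (D (Msum xs)) e ≡ coeff (qℕ (m + 2) · Msum ys) e
  at e (yes deg-e) = on-degree e deg-e
  at e (no deg-e≢) = begin
      coeff (D (Msum xs)) e
    ≡⟨ D-homogeneous (Msum xs) [] e (λ f eq → off-degree xs-enum f λ deg-f → deg-e≢ (trans (sym eq) (cong suc deg-f))) ⟩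
      0ℚ
    ≡⟨ ℚₚ.*-zeroʳ (qℕ (m + 2)) ⟨
      qℕ (m + 2) ℚ.* 0ℚ
    ≡⟨ cong (qℕ (m + 2) ℚ.*_) (off-degree ys-enum e λ deg-e → deg-e≢ deg-e) ⟨
      qℕ (m + 2) ℚ.* coeff (Msum ys) e
    ≡⟨ coeff-· (qℕ (m + 2)) (Msum ys) e ⟨
      coeff (qℕ (m + 2) · Msum ys) e
    ∎
    where open ≡-Reasoning

·-cong : ∀ k {p q} → p ≋ q → k · p ≋ k · q
·-cong k {p} {q} p≋q = mk≋ λ e → trans (coeff-· k p e) (trans (cong (k ℚ.*_) (coeff≡ p≋q e)) (sym (coeff-· k q e)))

·-· : ∀ a b p → a · (b · p) ≋ (a ℚ.* b) · p
·-· a b p = mk≋ λ e → trans (coeff-· a (b · p) e)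
  (trans (cong (a ℚ.*_) (coeff-· b p e)) (trans (sym (ℚₚ.*-assoc a b (coeff p e))) (sym (coeff-· (a ℚ.* b) p e))))

canonical : ℕ → List Tree
canonical m = slice m m

canonical-unique : ∀ m → Unique (canonical m)
canonical-unique m = slice-unique m m

canonical-enumerates : ∀ m → IsTipAugEnum (suc m) (canonical (suc m))
canonical-enumerates m = slice-enumerates (s≤s z≤n) ℕₚ.≤-refl

D-canonical : ∀ m → D (Msum (canonical (suc m))) ≋ qℕ (suc m + 2) · Msum (canonical (2 + m))
D-canonical m = D-Msum (s≤s z≤n) (canonical-unique (suc m)) (canonical-enumerates m)
                                 (canonical-unique (2 + m)) (canonical-enumerates (suc m))

D^-2u3 : ∀ n → D^ (suc n) (qℕ 2 · u3) ≋ qℕ ((suc n + 2) !) · Msum (canonical (2 + n))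
D^-2u3 zero = decide-≋ _ _ _
D^-2u3 (suc n) = begin
    D (D^ (suc n) (qℕ 2 · u3))                  ≈⟨ D-cong (D^-2u3 n) ⟩
    D (c · M (2 + n))                           ≈⟨ D-· c (M (2 + n)) ⟩
    c · D (M (2 + n))                           ≈⟨ ·-cong c (D-canonical (suc n)) ⟩
    c · (qℕ (2 + n + 2) · M (3 + n))            ≈⟨ ·-· c (qℕ (2 + n + 2)) (M (3 + n)) ⟩
    (c ℚ.* qℕ (2 + n + 2)) · M (3 + n)          ≡⟨ cong (_· M (3 + n)) c*[n+4]≡[n+4]! ⟩
    qℕ ((2 + n + 2) !) · M (3 + n)              ∎
  where
  open ≋-Reasoning
  M = λ k → Msum (canonical k)
  c = qℕ ((suc n + 2) !)
  c*[n+4]≡[n+4]! : c ℚ.* qℕ (2 + n + 2) ≡ qℕ ((2 + n + 2) !)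
  c*[n+4]≡[n+4]! = trans (ℚₚ.*-comm c (qℕ (2 + n + 2))) (sym (qℕ-* (2 + n + 2) ((suc n + 2) !)))

theorem4p1 : (n : ℕ) → 1 ≤ n → (ts : List Tree) → Unique ts → IsTipAugEnum (suc n) ts →
    D^ n (qℕ 2 · u3) ≈ qℕ ((n + 2) !) · Msum ts
theorem4p1 (suc n) _ ts ts! ts-enum = coeff≡ (≋-trans (D^-2u3 n)
  (·-cong (qℕ ((suc n + 2) !)) (enumerations-agree (canonical-unique (2 + n)) (canonical-enumerates (suc n)) ts! ts-enum)))
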